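{- Let $n\ge1$. For $w\in B_n$ write its inversion table as $I(w)=(inv_1(w):\cdots:inv_n(w))=(a_{n-1}:\cdots:a_1:a_0)$, i.e. $a_{n-i}=inv_i(w)$, and define \[ \phi(w)=\sigma_{n-1}^{a_{n-1}}\cdots\sigma_1^{a_1}\sigma_0^{a_0}\in B_n . \] Then $\phi:B_n\to B_n$ is a bijection and $inv(w)=fmaj(\phi(w))$ for every $w\in B_n$. In particular the statistics $inv$ and $fmaj$ are equidistributed on $B_n$: \[ \sum_{w\in B_n}q^{inv(w)}=\sum_{w\in B_n}q^{fmaj(w)}=\prod_{i=1}^n\frac{1-q^{2i}}{1-q}. \]
   Context: Let $e_1,\dots,e_n$ be the standard basis of $\mathbb{R}^n$. The hyperoctahedral group $B_n$ is the group of signed permutations: linear maps $w$ of $\mathbb{R}^n$ with $w(e_k)=\varepsilon_k e_{\beta(k)}$, $\beta\in S_n$, $\varepsilon_k\in\{\pm1\}$. It is generated by $t_1$ (the reflection with root $e_1$, negating $e_1$) and $s_1,\dots,s_{n-1}$ ($s_i$ the reflection with root $e_{i+1}-e_i$, swapping $e_i$ and $e_{i+1}$). Positive roots: $\Psi^+=\{e_l:1\le l\le n\}\cup\{e_j-e_i,\ e_j+e_i:1\le i<j\le n\}$, $\Psi^-=-\Psi^+$. For $i=1,\dots,n$ put $\Psi_i=\{e_{n+1-i}\}\cup\{e_{n+1-i}-e_j,\ e_{n+1-i}+e_j:1\le j<n+1-i\}$, $inv_i(w)=|w(\Psi_i)\cap\Psi^-|$ and $inv(w)=\sum_{i=1}^n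 inv_i(w)$; one has $0\le inv_i(w)\le 2(n-i)+1$. Let $\sigma_0=t_1$ and $\sigma_i=s_is_{i-1}\cdots s_1t_1$ for $1\le i\le n-1$. It is known (Adin–Roichman) that every $w\in B_n$ has a unique expression $w=\sigma_{n-1}^{k_{n-1}}\cdots\sigma_1^{k_1}\sigma_0^{k_0}$ with $0\le k_i\le 2i+1$; the flag-major index is $fmaj(w)=\sum_{i=0}^{n-1}k_i$. -}

module Defs where

open import Data.Bool using (Bool; true; false; if_then_else_; _∧_; _∨_; not; _xor_)
open import Data.Nat as ℕ using (ℕ; zero; suc; _<ᵇ_)
open import Data.Fin as Fin using (Fin; toℕ; inject₁)
import Data.Fin.Properties as FinP
open import Data.Integer as ℤ using (ℤ; 0ℤ; 1ℤ; -1ℤ)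
import Data.Integer.Properties as ℤP
open import Data.List as List using (List; []; _∷_; _++_; concatMap; allFin; upTo; foldl)
open import Data.Vec as Vec using (Vec; lookup; tabulate; zipWith; replicate)
import Data.Vec.Properties as VecP
open import Data.Product using (_×_; _,_; proj₁; proj₂)
import Data.Product.Properties as ProdP
import Data.Bool.Properties as BoolP
import Data.Bool.ListAction as BL
import Data.Nat.ListAction as NL
open import Relation.Nullary.Decidable using (⌊_⌋)
open import Relation.Binary.PropositionalEquality using (_≡_)

-- A raw vector v : V n encodes the linear map w with
--   w(e_k) = ε_k e_{β(k)},  β(k) = proj₁ (lookup v k),
--   ε_k = -1 if proj₂ (lookup v k) = true, +1 otherwise.
-- (Indices are 0-based: Fin n index k stands for e_{k+1}.)

V : ℕ → Set
V n = Vec (Fin n × Bool) n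

β : ∀ {n} → V n → Fin n → Fin n
β v k = proj₁ (lookup v k)

ε : ∀ {n} → V n → Fin n → Bool
ε v k = proj₂ (lookup v k)

isSignedPerm : ∀ {n} → V n → Bool
isSignedPerm {n} v =
  BL.all (λ i → BL.all (λ j → not ⌊ β v i Fin.≟ β v j ⌋ ∨ ⌊ i Fin.≟ j ⌋) (allFin n)) (allFin n)

InB : ∀ {n} → V n → Set
InB v = isSignedPerm v ≡ true

_≟V_ : ∀ {n} (u w : V n) → _
_≟V_ = VecP.≡-dec (ProdP.≡-dec Fin._≟_ BoolP._≟_)

allVecs : ∀ {A : Set} (m : ℕ) → List A → List (Vec A m)
allVecs zero    xs = Vec.[] ∷ []
allVecs (suc m) xs = concatMap (λ x → List.map (x Vec.∷_) (allVecs m xs)) xs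

allB : ∀ n → List (V n)
allB n = List.filterᵇ isSignedPerm
           (allVecs n (List.cartesianProduct (allFin n) (false ∷ true ∷ [])))

-- (u ∘ w)(e_k) = ε_k u(e_{β k}) = ε_k ε'_{β k} e_{β'(β k)}
_∘B_ : ∀ {n} → V n → V n → V n
u ∘B w = tabulate (λ k → β u (β w k) , (ε w k xor ε u (β w k)))

idB : ∀ {n} → V n
idB = tabulate (λ k → k , false)

_^B_ : ∀ {n} → V n → ℕ → V n
v ^B zero  = idB
v ^B suc k = v ∘B (v ^B k)

t₁ : ∀ {n} → V n
t₁ = tabulate (λ k → k , ⌊ toℕ k ℕ.≟ 0 ⌋)

-- s p (p : Fin m, n = suc m) is the paper's s_{p+1}: swaps e_{p+1} and e_{p+2},
-- i.e. 0-based indices (inject₁ p) and (suc p).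
swapIdx : ∀ {m} → Fin m → Fin (suc m) → Fin (suc m)
swapIdx p k = if ⌊ k Fin.≟ inject₁ p ⌋ then Fin.suc p
              else (if ⌊ k Fin.≟ Fin.suc p ⌋ then inject₁ p else k)

s : ∀ {m} → Fin m → V (suc m)
s p = tabulate (λ k → swapIdx p k , false)

-- σ₀ = t₁,  σ_i = s_i s_{i-1} ⋯ s₁ t₁  (i.e. σ_i = s_i σ_{i-1})
-- s_{i+1} given i : ℕ (identity if out of range; only used in range)
sℕ : ∀ {m} → ℕ → V (suc m)
sℕ {m} i = List.foldr (λ p r → if toℕ p ℕ.≡ᵇ i then s p else r) idB (allFin m)

σℕ : ∀ {m} → ℕ → V (suc m)
σℕ zero    = t₁
σℕ (suc i) = sℕ i ∘B σℕ i

σ : ∀ {m} → Fin (suc m) → V (suc m)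
σ k = σℕ (toℕ k)

σprod : ∀ {m} → (Fin (suc m) → ℕ) → V (suc m)
σprod {m} a = foldl (λ acc i → (σ i ^B a i) ∘B acc) idB (allFin (suc m))

Zn : ℕ → Set
Zn n = Vec ℤ n

_⊕_ : ∀ {n} → Zn n → Zn n → Zn n
_⊕_ = zipWith ℤ._+_

_⊖_ : ∀ {n} → Zn n → Zn n → Zn n
_⊖_ = zipWith ℤ._-_

negZ : ∀ {n} → Zn n → Zn n
negZ = Vec.map (λ z → ℤ.- z)

e : ∀ {n} → Fin n → Zn n
e k = tabulate (λ j → if ⌊ j Fin.≟ k ⌋ then 1ℤ else 0ℤ)

sgn : Bool → ℤ
sgn false = 1ℤ
sgn true  = -1ℤ

act : ∀ {n} → V n → Zn n → Zn n
act {n} v x = List.foldr _⊕_ (replicate n 0ℤ)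
  (List.map (λ k → Vec.map ((sgn (ε v k) ℤ.* lookup x k) ℤ.*_) (e (β v k))) (allFin n))

Ψ⁺ : ∀ n → List (Zn n)
Ψ⁺ n = List.map e (allFin n) ++
  concatMap (λ j → concatMap (λ i →
     if toℕ i <ᵇ toℕ j then (e j ⊖ e i) ∷ (e j ⊕ e i) ∷ [] else [])
     (allFin n)) (allFin n)

Ψ⁻ : ∀ n → List (Zn n)
Ψ⁻ n = List.map negZ (Ψ⁺ n)

-- Ψ'_r (r 0-based) = {e_r} ∪ {e_r - e_j, e_r + e_j : j < r}.
-- The paper's Ψ_i is Ψ'_{n-i} (0-based), i.e. the root set at e_{n+1-i}.
Ψ' : ∀ {n} → Fin n → List (Zn n)
Ψ' {n} r = e r ∷ concatMap (λ j →
     if toℕ j <ᵇ toℕ r then (e r ⊖ e j) ∷ (e r ⊕ e j) ∷ [] else [])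
     (allFin n)

_∈ᵇ_ : ∀ {n} → Zn n → List (Zn n) → Bool
x ∈ᵇ xs = BL.any (λ y → ⌊ VecP.≡-dec ℤ._≟_ y x ⌋) xs

-- |w(Ψ'_r) ∩ Ψ⁻|  (w is injective and Ψ'_r duplicate-free, so counting
-- the elements of Ψ'_r sent into Ψ⁻ gives the cardinality)
invAt : ∀ {n} → V n → Fin n → ℕ
invAt {n} v r = List.length (List.filterᵇ (λ x → act v x ∈ᵇ Ψ⁻ n) (Ψ' r))

-- inv_i(w) = invAt w (n - i) for the paper's i ∈ {1..n}
invᵢ : ∀ {n} → ℕ → V n → ℕ
invᵢ {n} i v = NL.sum (List.map (λ r → if toℕ r ℕ.≡ᵇ (n ℕ.∸ i) then invAt v r else 0) (allFin n))

inv : ∀ {n} → V n → ℕ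
inv {n} v = NL.sum (List.map (λ i → invᵢ (suc i) v) (upTo n))

-- Flag-major index via the (Adin–Roichman) unique normal form
--   w = σ_m^{k_m} ⋯ σ_0^{k_0},  0 ≤ k_i ≤ 2i+1,   fmaj w = Σ k_i

tuplesFrom : (len start : ℕ) → List (Vec ℕ len)
tuplesFrom zero    st = Vec.[] ∷ []
tuplesFrom (suc l) st =
  concatMap (λ k → List.map (k Vec.∷_) (tuplesFrom l (suc st))) (upTo (2 ℕ.* st ℕ.+ 2))

-- the exponent of the (first, in fact unique) normal form of v
fmaj : ∀ {m} → V (suc m) → ℕ
fmaj {m} v = List.foldr
  (λ k rest → if ⌊ σprod (lookup k) ≟V v ⌋ then Vec.sum k else rest)
  0 (tuplesFrom (suc m) 0)

φ : ∀ {m} → V (suc m) → V (suc m)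
φ {m} w = σprod (λ k → invᵢ (suc m ℕ.∸ toℕ k) w)

genfun : ∀ {n} → (V n → ℕ) → ℤ → ℤ
genfun {n} stat q = List.foldr ℤ._+_ 0ℤ (List.map (λ w → q ℤ.^ stat w) (allB n))

prodRHS : ℕ → ℤ → ℤ
prodRHS n q = List.foldr ℤ._*_ 1ℤ (List.map (λ i → 1ℤ ℤ.- q ℤ.^ (2 ℕ.* suc i)) (upTo n))

module Submission where

-- Write a signed permutation of {0, …, n-1} as a map k ↦ (position, sign).
-- Both ends of φ are unique factorisations w = γ_{n-1}(a_{n-1}) ⋯ γ_0(a_0) with
-- 0 ≤ a_m ≤ 2m+1, where γ_m(k) permutes {0, …, m} and its value at m determines k:
-- peeling off γ_{n-1} by the value of w at n-1 gives existence and uniqueness.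
-- With γ_m(k) = σ_m^k this is the Adin–Roichman normal form, whose exponent sum is
-- fmaj. With γ_m(k) the cycle inserting m at a position and sign chosen by k, it is
-- the inversion table: inserting m creates exactly a_m inversions at m and keeps
-- all relative positions below m, so a_m = inv_{n-m}(w) and inv w = Σ a_m.
-- Hence φ maps inversion tables to normal forms bijectively with inv = fmaj ∘ φ,
-- and the product formula counts the exponent tuples, each a_m ranging
-- independently over {0, …, 2m+1}.

open import Defs
open import Data.Bool using (Bool; true; false; not; _xor_; _∨_; if_then_else_; T)
open import Data.Bool.Properties using (xor-assoc; xor-same; xor-identityʳ; ∨-zeroʳ; T-≡)
open import Data.Empty using (⊥; ⊥-elim)
open import Data.Integer as ℤ using (ℤ; 0ℤ; 1ℤ; -1ℤ; _-_; _*_; _^_)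
import Data.Integer.Properties as ℤₚ
open import Data.Integer.Solver using (module +-*-Solver)
open import Algebra.Properties.CommutativeSemigroup ℤₚ.*-commutativeSemigroup using (interchange)
open import Data.Nat.ListAction using (sum)
open import Data.Nat as ℕ using (ℕ; zero; suc; pred; _+_; _∸_; _≤_; _<_; z≤n; s≤s; s≤s⁻¹; _≟_; _≤?_; _<?_; _<ᵇ_; _≡ᵇ_)
open import Data.Nat.Properties
open import Data.Product using (Σ; Σ-syntax; _×_; _,_; proj₁; proj₂)
open import Data.Product.Properties using (×-≡,≡→≡)
open import Data.Sum using (_⊎_; inj₁; inj₂)
open import Data.Fin as Fin using (Fin; toℕ; fromℕ<; inject₁)
import Data.Fin.Properties as Finₚ
open import Data.List as List using (List; []; _∷_; allFin)
open import Data.List.Membership.Propositional using (_∈_; lose; find)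
open import Data.List.Membership.Propositional.Properties
  using (∈-allFin; ∈-map⁺; ∈-map⁻; ∈-++⁺ˡ; ∈-++⁺ʳ; ∈-++⁻; ∈-concatMap⁺; ∈-concatMap⁻; ∈-upTo⁺; ∈-upTo⁻
        ; ∈-filter⁺; ∈-filter⁻; ∈-cartesianProduct⁺)
open import Data.List.Relation.Unary.Any using (here; there; satisfied)
open import Data.List.Relation.Unary.All as All using ()
import Data.List.Relation.Unary.All.Properties as Allₚ
import Data.List.Relation.Unary.AllPairs as AllPairs
open import Data.List.Relation.Unary.Unique.Propositional using (Unique)
import Data.List.Relation.Unary.Unique.Propositional.Properties as Uniqueₚ
open import Data.List.Relation.Binary.Permutation.Propositional using (_↭_; ↭⇒↭ₛ)
import Data.List.Relation.Binary.Permutation.Propositional.Properties as ↭ₚ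
open import Data.List.Relation.Binary.Permutation.Setoid.Properties using (foldr-commMonoid)
open import Data.List.Relation.Binary.BagAndSetEquality using (∼bag⇒↭)
open import Data.List.Membership.Propositional.Properties.WithK using (unique∧set⇒bag)
import Data.Bool.ListAction as BoolList
open import Data.Vec as Vec using (Vec; lookup; tabulate)
import Data.Vec.Properties as Vecₚ
import Data.List.Properties as Listₚ
open import Function using (_∘_; Equivalence; mk⇔)
open import Relation.Binary using (Tri; tri<; tri≈; tri>)
open import Relation.Binary.PropositionalEquality
open import Relation.Nullary using (Dec; yes; no)
open import Relation.Nullary.Decidable using (⌊_⌋; isYes≗does; dec-true; toWitness; T?)
import Relation.Binary.Reasoning.Setoid as SetoidReasoning

-- f k = (j , b) encodes e_{k+1} ↦ ± e_{j+1}, with sign − iff b; a signed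
-- permutation of {0, …, n-1} is extended by the identity beyond n.
SignedMap : Set
SignedMap = ℕ → ℕ × Bool

idₛ : SignedMap
idₛ k = k , false

infixr 9 _∘ₛ_

_∘ₛ_ : SignedMap → SignedMap → SignedMap
(f ∘ₛ g) k = proj₁ (f (proj₁ (g k))) , (proj₂ (g k) xor proj₂ (f (proj₁ (g k))))

AgreeBelow : ℕ → SignedMap → SignedMap → Set
AgreeBelow n f g = ∀ k → k < n → f k ≡ g k

∘ₛ-assoc : ∀ f g h → f ∘ₛ (g ∘ₛ h) ≗ (f ∘ₛ g) ∘ₛ h
∘ₛ-assoc f g h k = ×-≡,≡→≡ (refl , xor-assoc (proj₂ (h k)) _ _)

∘ₛ-identityˡ : ∀ f → idₛ ∘ₛ f ≗ f
∘ₛ-identityˡ f k = ×-≡,≡→≡ (refl , xor-identityʳ (proj₂ (f k)))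

∘ₛ-congˡ : ∀ {f f′} g → f ≗ f′ → f ∘ₛ g ≗ f′ ∘ₛ g
∘ₛ-congˡ g f≗f′ k rewrite f≗f′ (proj₁ (g k)) = refl

∘ₛ-congʳ : ∀ f {g g′} → g ≗ g′ → f ∘ₛ g ≗ f ∘ₛ g′
∘ₛ-congʳ f g≗g′ k rewrite g≗g′ k = refl

∘ₛ-cong-at : ∀ f {g g′} k → g k ≡ g′ k → (f ∘ₛ g) k ≡ (f ∘ₛ g′) k
∘ₛ-cong-at f k eq rewrite eq = refl

infixr 10 _^ₛ_

_^ₛ_ : SignedMap → ℕ → SignedMap
f ^ₛ zero  = idₛ
f ^ₛ suc k = f ∘ₛ f ^ₛ k

^ₛ-cong : ∀ {f g} → f ≗ g → ∀ k → f ^ₛ k ≗ g ^ₛ k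
^ₛ-cong f≗g zero    _ = refl
^ₛ-cong {f} {g} f≗g (suc k) x =
  trans (∘ₛ-congˡ (f ^ₛ k) f≗g x) (∘ₛ-congʳ g (^ₛ-cong f≗g k) x)

^ₛ-sucʳ : ∀ f k → f ^ₛ suc k ≗ f ^ₛ k ∘ₛ f
^ₛ-sucʳ f zero    x = sym (∘ₛ-identityˡ f x)
^ₛ-sucʳ f (suc k) = begin
  f ∘ₛ f ^ₛ suc k      ≈⟨ ∘ₛ-congʳ f (^ₛ-sucʳ f k) ⟩
  f ∘ₛ (f ^ₛ k ∘ₛ f)   ≈⟨ ∘ₛ-assoc f (f ^ₛ k) f ⟩
  f ^ₛ suc k ∘ₛ f      ∎
  where open SetoidReasoning (ℕ →-setoid (ℕ × Bool))

^ₛ-inverse : ∀ f g → g ∘ₛ f ≗ idₛ → ∀ k → g ^ₛ k ∘ₛ f ^ₛ k ≗ idₛ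
^ₛ-inverse f g g∘f≗id zero = ∘ₛ-identityˡ idₛ
^ₛ-inverse f g g∘f≗id (suc k) = begin
  g ^ₛ suc k ∘ₛ f ∘ₛ f ^ₛ k        ≈⟨ ∘ₛ-congˡ (f ∘ₛ f ^ₛ k) (^ₛ-sucʳ g k) ⟩
  (g ^ₛ k ∘ₛ g) ∘ₛ f ∘ₛ f ^ₛ k     ≈⟨ ∘ₛ-assoc (g ^ₛ k ∘ₛ g) f (f ^ₛ k) ⟩
  ((g ^ₛ k ∘ₛ g) ∘ₛ f) ∘ₛ f ^ₛ k   ≈⟨ ∘ₛ-congˡ (f ^ₛ k) (λ x → sym (∘ₛ-assoc (g ^ₛ k) g f x)) ⟩
  (g ^ₛ k ∘ₛ g ∘ₛ f) ∘ₛ f ^ₛ k     ≈⟨ ∘ₛ-congˡ (f ^ₛ k) (∘ₛ-congʳ (g ^ₛ k) g∘f≗id) ⟩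
  (g ^ₛ k ∘ₛ idₛ) ∘ₛ f ^ₛ k        ≈⟨ ^ₛ-inverse f g g∘f≗id k ⟩
  idₛ                              ∎
  where open SetoidReasoning (ℕ →-setoid (ℕ × Bool))

record SignedPermOn (n : ℕ) (f : SignedMap) : Set where
  field
    image< : ∀ k → k < n → proj₁ (f k) < n
    injective : ∀ j k → j < n → k < n → proj₁ (f j) ≡ proj₁ (f k) → j ≡ k
    fixed≥ : ∀ k → n ≤ k → f k ≡ (k , false)

open SignedPermOn

idₛ-signedPerm : ∀ {n} → SignedPermOn n idₛ
idₛ-signedPerm = record { image< = λ _ k<n → k<n ; injective = λ _ _ _ _ eq → eq ; fixed≥ = λ _ _ → refl }

∘ₛ-signedPerm : ∀ {n f g} → SignedPermOn n f → SignedPermOn n g → SignedPermOn n (f ∘ₛ g)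
∘ₛ-signedPerm {n} {f} {g} pf pg = record
  { image< = λ k k<n → image< pf _ (image< pg k k<n)
  ; injective = λ j k j<n k<n eq →
      injective pg j k j<n k<n (injective pf _ _ (image< pg j j<n) (image< pg k k<n) eq)
  ; fixed≥ = fixed }
  where
  fixed : ∀ k → n ≤ k → (f ∘ₛ g) k ≡ (k , false)
  fixed k n≤k rewrite fixed≥ pg k n≤k | fixed≥ pf k n≤k = refl

^ₛ-signedPerm : ∀ {n f} → SignedPermOn n f → ∀ k → SignedPermOn n (f ^ₛ k)
^ₛ-signedPerm pf zero    = idₛ-signedPerm
^ₛ-signedPerm pf (suc k) = ∘ₛ-signedPerm pf (^ₛ-signedPerm pf k)

signedPerm-fromLeftInverse : ∀ {n f g} → (∀ k → k < n → proj₁ (f k) < n) →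
  (∀ k → n ≤ k → f k ≡ (k , false)) → g ∘ₛ f ≗ idₛ → SignedPermOn n f
signedPerm-fromLeftInverse {f = f} {g} image fixed g∘f≗id = record
  { image< = image ; fixed≥ = fixed
  ; injective = λ j k _ _ eq → trans (sym (cong proj₁ (g∘f≗id j)))
      (trans (cong (λ x → proj₁ (g x)) eq) (cong proj₁ (g∘f≗id k))) }

signedPerm-suc : ∀ {m f} → SignedPermOn m f → SignedPermOn (suc m) f
signedPerm-suc {m} {f} pf = record
  { image< = image ; injective = inj ; fixed≥ = λ k sm≤k → fixed≥ pf k (≤-trans (n≤1+n m) sm≤k) }
  where
  fm : f m ≡ (m , false)
  fm = fixed≥ pf m ≤-refl
  image : ∀ k → k < suc m → proj₁ (f k) < suc m
  image k k<sm with m<1+n⇒m<n∨m≡n k<sm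
  ... | inj₁ k<m = m<n⇒m<1+n (image< pf k k<m)
  ... | inj₂ refl rewrite fm = ≤-refl
  inj : ∀ j k → j < suc m → k < suc m → proj₁ (f j) ≡ proj₁ (f k) → j ≡ k
  inj j k j<sm k<sm eq with m<1+n⇒m<n∨m≡n j<sm | m<1+n⇒m<n∨m≡n k<sm
  ... | inj₁ j<m  | inj₁ k<m  = injective pf j k j<m k<m eq
  ... | inj₁ j<m  | inj₂ refl rewrite fm = ⊥-elim (<-irrefl eq (image< pf j j<m))
  ... | inj₂ refl | inj₁ k<m  rewrite fm = ⊥-elim (<-irrefl (sym eq) (image< pf k k<m))
  ... | inj₂ refl | inj₂ refl = refl

signedPerm-pred : ∀ {m f} → SignedPermOn (suc m) f → f m ≡ (m , false) → SignedPermOn m f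
signedPerm-pred {m} {f} pf fm = record
  { image< = image
  ; injective = λ j k j<m k<m → injective pf j k (m<n⇒m<1+n j<m) (m<n⇒m<1+n k<m)
  ; fixed≥ = fixed }
  where
  image : ∀ k → k < m → proj₁ (f k) < m
  image k k<m with m<1+n⇒m<n∨m≡n (image< pf k (m<n⇒m<1+n k<m))
  ... | inj₁ lt = lt
  ... | inj₂ eq = ⊥-elim (<-irrefl (injective pf k m (m<n⇒m<1+n k<m) ≤-refl
                                       (trans eq (sym (cong proj₁ fm)))) k<m)
  fixed : ∀ k → m ≤ k → f k ≡ (k , false)
  fixed k m≤k with m≤n⇒m<n∨m≡n m≤k
  ... | inj₁ lt   = fixed≥ pf k lt
  ... | inj₂ refl = fm

xor-cancelʳ : ∀ a b c → a xor c ≡ b xor c → a ≡ b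
xor-cancelʳ a b false eq = trans (sym (xor-identityʳ a)) (trans eq (xor-identityʳ b))
xor-cancelʳ true  true  true _ = refl
xor-cancelʳ false false true _ = refl

∘ₛ-cancelˡ-at : ∀ {n h} (f g : SignedMap) k → SignedPermOn n h →
  proj₁ (f k) < n → proj₁ (g k) < n → (h ∘ₛ f) k ≡ (h ∘ₛ g) k → f k ≡ g k
∘ₛ-cancelˡ-at {h = h} f g k ph fk<n gk<n eq = ×-≡,≡→≡ (fst≡ ,
  xor-cancelʳ _ _ (proj₂ (h (proj₁ (g k))))
    (trans (cong (λ x → proj₂ (f k) xor proj₂ (h x)) (sym fst≡)) (cong proj₂ eq)))
  where
  fst≡ : proj₁ (f k) ≡ proj₁ (g k)
  fst≡ = injective ph _ _ fk<n gk<n (cong proj₁ eq)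

-- Unique factorisations

slots : ℕ → ℕ
slots k = 2 ℕ.* k + 2

Bounded : ℕ → (ℕ → ℕ) → Set
Bounded n a = ∀ k → k < n → a k < slots k

bounded-pred : ∀ {m a} → Bounded (suc m) a → Bounded m a
bounded-pred bnd k k<m = bnd k (m<n⇒m<1+n k<m)

slots≡ : ∀ m → slots m ≡ suc m + suc m
slots≡ m rewrite +-identityʳ m = trans (+-comm (m + m) 2) (cong suc (sym (+-suc m m)))

lower<slots : ∀ m x → x ≤ m → x < slots m
lower<slots m x x≤m = subst (x <_) (sym (slots≡ m)) (≤-trans (s≤s x≤m) (m≤m+n (suc m) (suc m)))

upper<slots : ∀ m x → x ≤ m → suc m + x < slots m
upper<slots m x x≤m = subst (suc m + x <_) (sym (slots≡ m)) (+-monoʳ-< (suc m) (s≤s x≤m))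

upper-half≤ : ∀ m k → k < slots m → k ∸ suc m ≤ m
upper-half≤ m k k<slots = s≤s⁻¹ (m<n+o⇒m∸n<o k (suc m) (subst (k <_) (slots≡ m) k<slots))

update : (ℕ → ℕ) → ℕ → ℕ → ℕ → ℕ
update a m k j with j ≟ m
... | yes _ = k
... | no _  = a j

update-same : ∀ a m k → update a m k m ≡ k
update-same a m k with m ≟ m
... | yes _ = refl
... | no m≢m = ⊥-elim (m≢m refl)

update-other : ∀ a m k j → j < m → update a m k j ≡ a j
update-other a m k j j<m with j ≟ m
... | yes refl = ⊥-elim (<-irrefl refl j<m)
... | no _     = refl

module Factorisation
  (γ γ⁻ : ℕ → ℕ → SignedMap)
  (γ-signedPerm : ∀ m k → k < slots m → SignedPermOn (suc m) (γ m k))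
  (γ⁻-signedPerm : ∀ m k → k < slots m → SignedPermOn (suc m) (γ⁻ m k))
  (γ⁻∘γ : ∀ m k → k < slots m → γ⁻ m k ∘ₛ γ m k ≗ idₛ)
  (γ∘γ⁻ : ∀ m k → k < slots m → γ m k ∘ₛ γ⁻ m k ≗ idₛ)
  (γ-top-injective : ∀ m k k′ → k < slots m → k′ < slots m → γ m k m ≡ γ m k′ m → k ≡ k′)
  (γ-top-surjective : ∀ m t b → t ≤ m → Σ[ k ∈ ℕ ] k < slots m × γ m k m ≡ (t , b))
  where

  prod : (ℕ → ℕ) → ℕ → SignedMap
  prod a zero    = idₛ
  prod a (suc m) = γ m (a m) ∘ₛ prod a m

  prod-signedPerm : ∀ n a → Bounded n a → SignedPermOn n (prod a n)
  prod-signedPerm zero    a bnd = idₛ-signedPerm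
  prod-signedPerm (suc m) a bnd = ∘ₛ-signedPerm (γ-signedPerm m (a m) (bnd m ≤-refl))
    (signedPerm-suc (prod-signedPerm m a (bounded-pred bnd)))

  prod-cong : ∀ n a a′ → (∀ k → k < n → a k ≡ a′ k) → prod a n ≗ prod a′ n
  prod-cong zero    a a′ eq = λ _ → refl
  prod-cong (suc m) a a′ eq rewrite eq m ≤-refl =
    ∘ₛ-congʳ (γ m (a′ m)) (prod-cong m a a′ (λ k k<m → eq k (m<n⇒m<1+n k<m)))

  prod-top : ∀ m a → Bounded m a → prod a m m ≡ (m , false)
  prod-top m a bnd = fixed≥ (prod-signedPerm m a bnd) m ≤-refl

  prod-suc-top : ∀ m a → Bounded (suc m) a → prod a (suc m) m ≡ γ m (a m) m
  prod-suc-top m a bnd = ∘ₛ-cong-at (γ m (a m)) {prod a m} {idₛ} m (prod-top m a (bounded-pred bnd))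

  prod-top-injective : ∀ m a a′ → Bounded (suc m) a → Bounded (suc m) a′ →
    prod a (suc m) m ≡ prod a′ (suc m) m → a m ≡ a′ m
  prod-top-injective m a a′ bnd bnd′ eq = γ-top-injective m _ _ (bnd m ≤-refl) (bnd′ m ≤-refl)
    (trans (sym (prod-suc-top m a bnd)) (trans eq (prod-suc-top m a′ bnd′)))

  prod-injective : ∀ n a a′ → Bounded n a → Bounded n a′ →
    AgreeBelow n (prod a n) (prod a′ n) → ∀ k → k < n → a k ≡ a′ k
  prod-injective (suc m) a a′ bnd bnd′ agree k k<sm with m<1+n⇒m<n∨m≡n k<sm
  ... | inj₁ k<m  = prod-injective m a a′ (bounded-pred bnd) (bounded-pred bnd′) agree-m k k<m
    where
    am≡a′m = prod-top-injective m a a′ bnd bnd′ (agree m ≤-refl)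
    agree-m : AgreeBelow m (prod a m) (prod a′ m)
    agree-m j j<m = ∘ₛ-cancelˡ-at (prod a m) (prod a′ m) j (γ-signedPerm m (a m) (bnd m ≤-refl))
      (m<n⇒m<1+n (image< (prod-signedPerm m a (bounded-pred bnd)) j j<m))
      (m<n⇒m<1+n (image< (prod-signedPerm m a′ (bounded-pred bnd′)) j j<m))
      (trans (agree j (m<n⇒m<1+n j<m)) (cong (λ x → (γ m x ∘ₛ prod a′ m) j) (sym am≡a′m)))
  ... | inj₂ refl = prod-top-injective m a a′ bnd bnd′ (agree m ≤-refl)

  prod-surjective : ∀ n f → SignedPermOn n f → Σ[ a ∈ (ℕ → ℕ) ] Bounded n a × AgreeBelow n (prod a n) f
  prod-surjective zero    f pf = (λ _ → 0) , (λ _ ()) , (λ _ ())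
  prod-surjective (suc m) f pf = a′ , bnd′ , agree′
    where
    top = γ-top-surjective m (proj₁ (f m)) (proj₂ (f m)) (s≤s⁻¹ (image< pf m ≤-refl))
    k = proj₁ top
    k<slots = proj₁ (proj₂ top)
    g = γ⁻ m k ∘ₛ f
    gm≡m : g m ≡ (m , false)
    gm≡m = trans (∘ₛ-cong-at (γ⁻ m k) {f} {γ m k} m (sym (proj₂ (proj₂ top)))) (γ⁻∘γ m k k<slots m)
    ih = prod-surjective m g (signedPerm-pred (∘ₛ-signedPerm (γ⁻-signedPerm m k k<slots) pf) gm≡m)
    a = proj₁ ih
    bnd = proj₁ (proj₂ ih)
    a′ = update a m k
    bnd′ : Bounded (suc m) a′
    bnd′ j j<sm with m<1+n⇒m<n∨m≡n j<sm
    ... | inj₁ j<m  rewrite update-other a m k j j<m = bnd j j<m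
    ... | inj₂ refl rewrite update-same a m k = k<slots
    agree-g : AgreeBelow (suc m) (prod a′ m) g
    agree-g j j<sm with m<1+n⇒m<n∨m≡n j<sm
    ... | inj₁ j<m  = trans (prod-cong m a′ a (update-other a m k) j) (proj₂ (proj₂ ih) j j<m)
    ... | inj₂ refl = trans (prod-cong m a′ a (update-other a m k) j) (trans (prod-top m a bnd) (sym gm≡m))
    agree′ : AgreeBelow (suc m) (prod a′ (suc m)) f
    agree′ j j<sm rewrite update-same a m k =
      trans (∘ₛ-cong-at (γ m k) {prod a′ m} {g} j (agree-g j j<sm))
        (trans (∘ₛ-assoc (γ m k) (γ⁻ m k) f j) (trans (∘ₛ-congˡ f (γ∘γ⁻ m k k<slots) j) (∘ₛ-identityˡ f j)))

-- σ_m = s_m ⋯ s_1 t_1 sends e_1 ↦ − e_{m+1} and e_{k+1} ↦ e_k for 1 ≤ k ≤ m.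
σₛ : ℕ → SignedMap
σₛ m zero = m , true
σₛ m (suc k) with k <? m
... | yes _ = k , false
... | no _  = suc k , false

σₛ⁻¹ : ℕ → SignedMap
σₛ⁻¹ m k with <-cmp k m
... | tri< _ _ _ = suc k , false
... | tri≈ _ _ _ = 0 , true
... | tri> _ _ _ = k , false

σₛ⁻¹∘σₛ : ∀ m → σₛ⁻¹ m ∘ₛ σₛ m ≗ idₛ
σₛ⁻¹∘σₛ m zero with <-cmp m m
... | tri< m<m _ _ = ⊥-elim (<-irrefl refl m<m)
... | tri≈ _ _ _   = refl
... | tri> _ _ m>m = ⊥-elim (<-irrefl refl m>m)
σₛ⁻¹∘σₛ m (suc k) with k <? m
σₛ⁻¹∘σₛ m (suc k) | yes k<m with <-cmp k m
... | tri< _ _ _   = refl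
... | tri≈ _ k≡m _ = ⊥-elim (<-irrefl k≡m k<m)
... | tri> _ _ k>m = ⊥-elim (<-asym k<m k>m)
σₛ⁻¹∘σₛ m (suc k) | no k≮m with <-cmp (suc k) m
... | tri< k+1<m _ _ = ⊥-elim (k≮m (<-trans (n<1+n k) k+1<m))
... | tri≈ _ k+1≡m _ = ⊥-elim (k≮m (subst (k <_) k+1≡m (n<1+n k)))
... | tri> _ _ _     = refl

σₛ∘σₛ⁻¹ : ∀ m → σₛ m ∘ₛ σₛ⁻¹ m ≗ idₛ
σₛ∘σₛ⁻¹ m k with <-cmp k m
σₛ∘σₛ⁻¹ m k | tri< k<m _ _ with k <? m
... | yes _  = refl
... | no k≮m = ⊥-elim (k≮m k<m)
σₛ∘σₛ⁻¹ m k | tri≈ _ refl _ = refl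
σₛ∘σₛ⁻¹ m (suc k) | tri> _ _ k+1>m with k <? m
... | yes k<m = ⊥-elim (<-irrefl refl (<-≤-trans k<m (s≤s⁻¹ k+1>m)))
... | no _    = refl

σₛ-signedPerm : ∀ m → SignedPermOn (suc m) (σₛ m)
σₛ-signedPerm m = signedPerm-fromLeftInverse {g = σₛ⁻¹ m} image fixed (σₛ⁻¹∘σₛ m)
  where
  image : ∀ k → k < suc m → proj₁ (σₛ m k) < suc m
  image zero    _ = ≤-refl
  image (suc k) k+1≤m with k <? m
  ... | yes k<m = m<n⇒m<1+n k<m
  ... | no _    = k+1≤m
  fixed : ∀ k → suc m ≤ k → σₛ m k ≡ (k , false)
  fixed (suc k) m+1≤k+1 with k <? m
  ... | yes k<m = ⊥-elim (<-irrefl refl (<-≤-trans k<m (s≤s⁻¹ m+1≤k+1)))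
  ... | no _    = refl

σₛ⁻¹-signedPerm : ∀ m → SignedPermOn (suc m) (σₛ⁻¹ m)
σₛ⁻¹-signedPerm m = signedPerm-fromLeftInverse {g = σₛ m} image fixed (σₛ∘σₛ⁻¹ m)
  where
  image : ∀ k → k < suc m → proj₁ (σₛ⁻¹ m k) < suc m
  image k k≤m with <-cmp k m
  ... | tri< k<m _ _ = s≤s k<m
  ... | tri≈ _ _ _   = s≤s z≤n
  ... | tri> _ _ k>m = ⊥-elim (<-irrefl refl (<-≤-trans k>m (s≤s⁻¹ k≤m)))
  fixed : ∀ k → suc m ≤ k → σₛ⁻¹ m k ≡ (k , false)
  fixed k m<k with <-cmp k m
  ... | tri< k<m _ _  = ⊥-elim (<-asym k<m m<k)
  ... | tri≈ _ refl _ = ⊥-elim (<-irrefl refl m<k)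
  ... | tri> _ _ _    = refl

σₛ-below : ∀ m j → j < m → σₛ m (suc j) ≡ (j , false)
σₛ-below m j j<m with j <? m
... | yes _  = refl
... | no j≮m = ⊥-elim (j≮m j<m)

-- σ_m^k moves e_{m+1} down through e_m, …, e_1 and then, signed, from e_{m+1} down again.
σₛ^-top-unsigned : ∀ m i j → i + j ≡ m → (σₛ m ^ₛ i) m ≡ (j , false)
σₛ^-top-unsigned m zero    j refl = refl
σₛ^-top-unsigned m (suc i) j i+1+j≡m
  rewrite σₛ^-top-unsigned m i (suc j) (trans (+-suc i j) i+1+j≡m) =
  σₛ-below m j (subst (j <_) i+1+j≡m (s≤s (m≤n+m j i)))

σₛ^-top-signed : ∀ m i j → i + j ≡ m → (σₛ m ^ₛ (suc m + i)) m ≡ (j , true)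
σₛ^-top-signed m zero j refl
  rewrite +-identityʳ j | σₛ^-top-unsigned j j 0 (+-identityʳ j) = refl
σₛ^-top-signed m (suc i) j i+1+j≡m = begin
  (σₛ m ^ₛ (suc m + suc i)) m        ≡⟨ cong (λ x → (σₛ m ^ₛ x) m) (+-suc (suc m) i) ⟩
  (σₛ m ∘ₛ σₛ m ^ₛ (suc m + i)) m    ≡⟨ ∘ₛ-cong-at (σₛ m) {σₛ m ^ₛ (suc m + i)} {λ _ → suc j , true} m
                                          (σₛ^-top-signed m i (suc j) (trans (+-suc i j) i+1+j≡m)) ⟩
  (proj₁ (σₛ m (suc j)) , true xor proj₂ (σₛ m (suc j)))
                                     ≡⟨ cong (λ p → proj₁ p , true xor proj₂ p)
                                          (σₛ-below m j (subst (j <_) i+1+j≡m (s≤s (m≤n+m j i)))) ⟩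
  (j , true)                         ∎
  where open ≡-Reasoning

flagTop : ℕ → ℕ → ℕ × Bool
flagTop m k with k ≤? m
... | yes _ = m ∸ k , false
... | no _  = m ∸ (k ∸ suc m) , true

σₛ^-top : ∀ m k → k < slots m → (σₛ m ^ₛ k) m ≡ flagTop m k
σₛ^-top m k k<slots with k ≤? m
... | yes k≤m = σₛ^-top-unsigned m k (m ∸ k) (m+[n∸m]≡n k≤m)
... | no k≰m  = trans (cong (λ x → (σₛ m ^ₛ x) m) (sym (m+[n∸m]≡n (≰⇒> k≰m))))
  (σₛ^-top-signed m (k ∸ suc m) _ (m+[n∸m]≡n (upper-half≤ m k k<slots)))

flagTop-injective : ∀ m k k′ → k < slots m → k′ < slots m → flagTop m k ≡ flagTop m k′ → k ≡ k′
flagTop-injective m k k′ k<slots k′<slots eq with k ≤? m | k′ ≤? m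
... | yes k≤m | yes k′≤m = ∸-cancelˡ-≡ k≤m k′≤m (cong proj₁ eq)
... | no k≰m  | no k′≰m  = begin
  k                      ≡⟨ m+[n∸m]≡n (≰⇒> k≰m) ⟨
  suc m + (k ∸ suc m)    ≡⟨ cong (suc m +_) (∸-cancelˡ-≡ (upper-half≤ m k k<slots)
                              (upper-half≤ m k′ k′<slots) (cong proj₁ eq)) ⟩
  suc m + (k′ ∸ suc m)   ≡⟨ m+[n∸m]≡n (≰⇒> k′≰m) ⟩
  k′                     ∎
  where open ≡-Reasoning
... | yes _ | no _ with () ← cong proj₂ eq
... | no _ | yes _ with () ← cong proj₂ eq

flagTop-surjective : ∀ m t b → t ≤ m → Σ[ k ∈ ℕ ] k < slots m × flagTop m k ≡ (t , b)
flagTop-surjective m t false t≤m = m ∸ t , lower<slots m _ (m∸n≤m m t) , value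
  where
  value : flagTop m (m ∸ t) ≡ (t , false)
  value with m ∸ t ≤? m
  ... | yes _ = cong (_, false) (m∸[m∸n]≡n t≤m)
  ... | no m∸t≰m = ⊥-elim (m∸t≰m (m∸n≤m m t))
flagTop-surjective m t true t≤m = suc m + (m ∸ t) , upper<slots m _ (m∸n≤m m t) , value
  where
  value : flagTop m (suc m + (m ∸ t)) ≡ (t , true)
  value with suc m + (m ∸ t) ≤? m
  ... | yes m+1+x≤m = ⊥-elim (<-irrefl refl (≤-trans m+1+x≤m (m≤m+n m (m ∸ t))))
  ... | no _ = cong (_, true) (trans (cong (m ∸_) (m+n∸m≡n (suc m) (m ∸ t))) (m∸[m∸n]≡n t≤m))

σₛ^-top-injective : ∀ m k k′ → k < slots m → k′ < slots m → (σₛ m ^ₛ k) m ≡ (σₛ m ^ₛ k′) m → k ≡ k′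
σₛ^-top-injective m k k′ k<slots k′<slots eq = flagTop-injective m k k′ k<slots k′<slots
  (trans (sym (σₛ^-top m k k<slots)) (trans eq (σₛ^-top m k′ k′<slots)))

σₛ^-top-surjective : ∀ m t b → t ≤ m → Σ[ k ∈ ℕ ] k < slots m × (σₛ m ^ₛ k) m ≡ (t , b)
σₛ^-top-surjective m t b t≤m with flagTop-surjective m t b t≤m
... | k , k<slots , top≡ = k , k<slots , trans (σₛ^-top m k k<slots) top≡

module FlagNormalForm = Factorisation
  (λ m k → σₛ m ^ₛ k) (λ m k → σₛ⁻¹ m ^ₛ k)
  (λ m k _ → ^ₛ-signedPerm (σₛ-signedPerm m) k) (λ m k _ → ^ₛ-signedPerm (σₛ⁻¹-signedPerm m) k)
  (λ m k _ → ^ₛ-inverse (σₛ m) (σₛ⁻¹ m) (σₛ⁻¹∘σₛ m) k) (λ m k _ → ^ₛ-inverse (σₛ⁻¹ m) (σₛ m) (σₛ∘σₛ⁻¹ m) k)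
  σₛ^-top-injective σₛ^-top-surjective

Σ< : ℕ → (ℕ → ℕ) → ℕ
Σ< zero    f = 0
Σ< (suc n) f = Σ< n f + f n

Σ<-cong : ∀ n {f g : ℕ → ℕ} → (∀ j → j < n → f j ≡ g j) → Σ< n f ≡ Σ< n g
Σ<-cong zero    eq = refl
Σ<-cong (suc n) eq = cong₂ _+_ (Σ<-cong n (λ j j<n → eq j (m<n⇒m<1+n j<n))) (eq n ≤-refl)

Σ<-+ : ∀ n (f g : ℕ → ℕ) → Σ< n (λ j → f j + g j) ≡ Σ< n f + Σ< n g
Σ<-+ zero    f g = refl
Σ<-+ (suc n) f g rewrite Σ<-+ n f g = +-exchange (Σ< n f) (Σ< n g) (f n) (g n)
  where
  +-exchange : ∀ a b c d → a + b + (c + d) ≡ a + c + (b + d)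
  +-exchange a b c d rewrite +-assoc a b (c + d) | +-assoc a c (b + d)
    | sym (+-assoc b c d) | +-comm b c | +-assoc c b d = refl

Σ<-const : ∀ n c → Σ< n (λ _ → c) ≡ n ℕ.* c
Σ<-const zero    c = refl
Σ<-const (suc n) c rewrite Σ<-const n c = +-comm (n ℕ.* c) c

Σ<-ones : ∀ n → Σ< n (λ _ → 1) ≡ n
Σ<-ones n = trans (Σ<-const n 1) (*-identityʳ n)

Σ<-zero : ∀ n (f : ℕ → ℕ) → (∀ j → j < n → f j ≡ 0) → Σ< n f ≡ 0
Σ<-zero n f zeros = trans (Σ<-cong n zeros) (trans (Σ<-const n 0) (*-zeroʳ n))

Σ<-comm : ∀ a b (f : ℕ → ℕ → ℕ) → Σ< a (λ i → Σ< b (f i)) ≡ Σ< b (λ j → Σ< a (λ i → f i j))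
Σ<-comm zero    b f = sym (Σ<-zero b _ (λ _ _ → refl))
Σ<-comm (suc a) b f rewrite Σ<-comm a b f = sym (Σ<-+ b (λ j → Σ< a (λ i → f i j)) (f a))

Σ<-mono-≤ : ∀ n {f g : ℕ → ℕ} → (∀ j → j < n → f j ≤ g j) → Σ< n f ≤ Σ< n g
Σ<-mono-≤ zero    le = z≤n
Σ<-mono-≤ (suc n) le = +-mono-≤ (Σ<-mono-≤ n (λ j j<n → le j (m<n⇒m<1+n j<n))) (le n ≤-refl)

Σ<-suc : ∀ n (f : ℕ → ℕ) → Σ< (suc n) f ≡ f 0 + Σ< n (f ∘ suc)
Σ<-suc zero    f = +-comm 0 (f 0)
Σ<-suc (suc n) f rewrite Σ<-suc n f = +-assoc (f 0) _ _

Σ<-reverse : ∀ n (f : ℕ → ℕ) → Σ< n (λ i → f (n ∸ suc i)) ≡ Σ< n f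
Σ<-reverse zero    f = refl
Σ<-reverse (suc n) f = begin
  Σ< n (λ i → f (suc n ∸ suc i)) + f (n ∸ n)  ≡⟨ cong₂ _+_ (Σ<-cong n (λ i i<n → cong f (+-∸-assoc 1 i<n)))
                                                              (cong f (n∸n≡0 n)) ⟩
  Σ< n (λ i → f (suc (n ∸ suc i))) + f 0      ≡⟨ cong (_+ f 0) (Σ<-reverse n (f ∘ suc)) ⟩
  Σ< n (f ∘ suc) + f 0                        ≡⟨ +-comm _ (f 0) ⟩
  f 0 + Σ< n (f ∘ suc)                        ≡⟨ Σ<-suc n f ⟨
  Σ< (suc n) f                                ∎
  where open ≡-Reasoning

Σ<-truncate : ∀ n r (f : ℕ → ℕ) → r ≤ n → (∀ k → r ≤ k → k < n → f k ≡ 0) → Σ< n f ≡ Σ< r f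
Σ<-truncate n r f r≤n zeros with m≤n⇒m<n∨m≡n r≤n
Σ<-truncate (suc n) r f r≤n zeros | inj₁ r<n+1
  rewrite zeros n (s≤s⁻¹ r<n+1) ≤-refl | +-identityʳ (Σ< n f) =
  Σ<-truncate n r f (s≤s⁻¹ r<n+1) (λ k r≤k k<n → zeros k r≤k (m<n⇒m<1+n k<n))
... | inj₂ refl = refl

𝟙≡ : ℕ → ℕ → ℕ
𝟙≡ x y with x ≟ y
... | yes _ = 1
... | no _  = 0

𝟙< : ℕ → ℕ → ℕ
𝟙< x y with x <? y
... | yes _ = 1
... | no _  = 0

𝟙≡-refl : ∀ x → 𝟙≡ x x ≡ 1
𝟙≡-refl x with x ≟ x
... | yes _ = refl
... | no x≢x = ⊥-elim (x≢x refl)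

𝟙≡-≢ : ∀ x y → x ≢ y → 𝟙≡ x y ≡ 0
𝟙≡-≢ x y x≢y with x ≟ y
... | yes x≡y = ⊥-elim (x≢y x≡y)
... | no _    = refl

𝟙<-< : ∀ x y → x < y → 𝟙< x y ≡ 1
𝟙<-< x y x<y with x <? y
... | yes _   = refl
... | no x≮y = ⊥-elim (x≮y x<y)

𝟙<-> : ∀ x y → y < x → 𝟙< x y ≡ 0
𝟙<-> x y y<x with x <? y
... | yes x<y = ⊥-elim (<-asym x<y y<x)
... | no _    = refl

𝟙<-≤1 : ∀ x y → 𝟙< x y ≤ 1
𝟙<-≤1 x y with x <? y
... | yes _ = s≤s z≤n
... | no _  = z≤n

𝟙<-zero : ∀ x → 𝟙< x 0 ≡ 0
𝟙<-zero x with x <? 0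
... | no _ = refl

𝟙<-suc : ∀ x t → 𝟙< x (suc t) ≡ 𝟙< x t + 𝟙≡ x t
𝟙<-suc x t with x <? suc t | x <? t | x ≟ t
... | yes _     | yes x<t  | yes refl = ⊥-elim (<-irrefl refl x<t)
... | yes _     | yes _    | no _     = refl
... | yes _     | no _     | yes _    = refl
... | yes x<t+1 | no x≮t   | no x≢t   = ⊥-elim (x≢t (≤∧≮⇒≡ (s≤s⁻¹ x<t+1) x≮t))
... | no x≮t+1  | yes x<t  | _        = ⊥-elim (x≮t+1 (m<n⇒m<1+n x<t))
... | no x≮t+1  | no _     | yes refl = ⊥-elim (x≮t+1 ≤-refl)
... | no _      | no _     | no _     = refl

Σ<-𝟙≡ : ∀ m x → x < m → Σ< m (𝟙≡ x) ≡ 1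
Σ<-𝟙≡ (suc m) x x<m+1 with m<1+n⇒m<n∨m≡n x<m+1
... | inj₁ x<m rewrite Σ<-𝟙≡ m x x<m | 𝟙≡-≢ x m (λ x≡m → <-irrefl x≡m x<m) = refl
... | inj₂ refl rewrite 𝟙≡-refl x
  | Σ<-zero x (𝟙≡ x) (λ j j<x → 𝟙≡-≢ x j (λ x≡j → <-irrefl (sym x≡j) j<x)) = refl

+-≡-at-bounds : ∀ {a b m} → a ≤ m → b ≤ 1 → a + b ≡ suc m → a ≡ m × b ≡ 1
+-≡-at-bounds {a} {b} {m} a≤m b≤1 eq =
  a≡m , +-cancelˡ-≡ m b 1 (trans (cong (_+ b) (sym a≡m)) (trans eq (+-comm 1 m)))
  where
  a≡m : a ≡ m
  a≡m = ≤-antisym a≤m (s≤s⁻¹ (subst (suc m ≤_) (+-comm a 1) (subst (_≤ a + 1) eq (+-monoʳ-≤ a b≤1))))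

Σ<≡length⇒≡1 : ∀ m (h : ℕ → ℕ) → (∀ t → t < m → h t ≤ 1) → Σ< m h ≡ m → ∀ t → t < m → h t ≡ 1
Σ<≡length⇒≡1 (suc m) h h≤1 total t t<m+1 = split (m<1+n⇒m<n∨m≡n t<m+1)
  where
  h≤1′ : ∀ j → j < m → h j ≤ 1
  h≤1′ j j<m = h≤1 j (m<n⇒m<1+n j<m)
  both : Σ< m h ≡ m × h m ≡ 1
  both = +-≡-at-bounds (subst (Σ< m h ≤_) (Σ<-ones m) (Σ<-mono-≤ m h≤1′)) (h≤1 m ≤-refl) total
  split : t < m ⊎ t ≡ m → h t ≡ 1
  split (inj₁ t<m)  = Σ<≡length⇒≡1 m h h≤1′ (proj₁ both) t t<m
  split (inj₂ refl) = proj₂ both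

Σ<-𝟙≡-≤1 : ∀ {m} g → SignedPermOn m g → ∀ t n → n ≤ m → Σ< n (λ j → 𝟙≡ (proj₁ (g j)) t) ≤ 1
Σ<-𝟙≡-≤1 g pg t zero    _ = z≤n
Σ<-𝟙≡-≤1 g pg t (suc n) n<m = split (proj₁ (g n) ≟ t)
  where
  split : Dec (proj₁ (g n) ≡ t) → Σ< (suc n) (λ j → 𝟙≡ (proj₁ (g j)) t) ≤ 1
  split (yes refl) rewrite 𝟙≡-refl (proj₁ (g n))
    | Σ<-zero n (λ j → 𝟙≡ (proj₁ (g j)) (proj₁ (g n))) (λ j j<n → 𝟙≡-≢ _ _ (λ gj≡gn →
        <-irrefl (injective pg j n (<-trans j<n n<m) n<m gj≡gn) j<n)) = ≤-refl
  split (no gn≢t) rewrite 𝟙≡-≢ _ t gn≢t | +-identityʳ (Σ< n (λ j → 𝟙≡ (proj₁ (g j)) t)) =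
    Σ<-𝟙≡-≤1 g pg t n (<⇒≤ n<m)

-- Each value t < m is hit exactly once (at most once by injectivity, and m times
-- in total), so counting the j with g j < t counts the values below t.
Σ<-𝟙<-signedPerm : ∀ m g → SignedPermOn m g → ∀ t → t ≤ m → Σ< m (λ j → 𝟙< (proj₁ (g j)) t) ≡ t
Σ<-𝟙<-signedPerm m g pg zero    _ = Σ<-zero m _ (λ j _ → 𝟙<-zero (proj₁ (g j)))
Σ<-𝟙<-signedPerm m g pg (suc t) t<m = begin
  Σ< m (λ j → 𝟙< (proj₁ (g j)) (suc t))          ≡⟨ Σ<-cong m (λ j _ → 𝟙<-suc (proj₁ (g j)) t) ⟩
  Σ< m (λ j → 𝟙< (proj₁ (g j)) t + hits′ j)      ≡⟨ Σ<-+ m _ _ ⟩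
  Σ< m (λ j → 𝟙< (proj₁ (g j)) t) + Σ< m hits′   ≡⟨ cong₂ _+_ (Σ<-𝟙<-signedPerm m g pg t (<⇒≤ t<m))
                                                            (Σ<≡length⇒≡1 m hits hits≤1 total t t<m) ⟩
  t + 1                                          ≡⟨ +-comm t 1 ⟩
  suc t                                          ∎
  where
  open ≡-Reasoning
  hits : ℕ → ℕ
  hits s = Σ< m (λ j → 𝟙≡ (proj₁ (g j)) s)
  hits′ : ℕ → ℕ
  hits′ j = 𝟙≡ (proj₁ (g j)) t
  hits≤1 : ∀ s → s < m → hits s ≤ 1
  hits≤1 s _ = Σ<-𝟙≡-≤1 g pg s m ≤-refl
  total : Σ< m hits ≡ m
  total = begin
    Σ< m hits                                      ≡⟨ Σ<-comm m m (λ s j → 𝟙≡ (proj₁ (g j)) s) ⟩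
    Σ< m (λ j → Σ< m (𝟙≡ (proj₁ (g j))))           ≡⟨ Σ<-cong m (λ j j<m → Σ<-𝟙≡ m _ (image< pg j j<m)) ⟩
    Σ< m (λ _ → 1)                                 ≡⟨ Σ<-ones m ⟩
    m                                              ∎

-- Insertion cycles and the inversion table

shiftFrom : ℕ → ℕ → ℕ
shiftFrom t u with t ≤? u
... | yes _ = suc u
... | no _  = u

shiftFrom-≥ : ∀ t u → t ≤ u → shiftFrom t u ≡ suc u
shiftFrom-≥ t u t≤u with t ≤? u
... | yes _   = refl
... | no t≰u = ⊥-elim (t≰u t≤u)

shiftFrom-< : ∀ t u → u < t → shiftFrom t u ≡ u
shiftFrom-< t u u<t with t ≤? u
... | yes t≤u = ⊥-elim (<-irrefl refl (<-≤-trans u<t t≤u))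
... | no _    = refl

shiftFrom-mono-< : ∀ t u v → u < v → shiftFrom t u < shiftFrom t v
shiftFrom-mono-< t u v u<v with t ≤? u | t ≤? v
... | yes _   | yes _   = s≤s u<v
... | no _    | no _    = u<v
... | no _    | yes _   = m<n⇒m<1+n u<v
... | yes t≤u | no t≰v = ⊥-elim (t≰v (≤-trans t≤u (<⇒≤ u<v)))

shiftFrom-cancel-< : ∀ t u v → shiftFrom t u < shiftFrom t v → u < v
shiftFrom-cancel-< t u v lt with t ≤? u | t ≤? v
... | yes _   | yes _   = s≤s⁻¹ lt
... | no _    | no _    = lt
... | no t≰u  | yes t≤v = <-≤-trans (≰⇒> t≰u) t≤v
... | yes t≤u | no t≰v  = ⊥-elim (<-irrefl refl (≤-<-trans t≤u (<-trans (n<1+n u) (<-trans lt (≰⇒> t≰v)))))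

shiftFrom-<-iff : ∀ t u → shiftFrom t u < t → u < t
shiftFrom-<-iff t u lt with t ≤? u
... | yes t≤u = ⊥-elim (<-irrefl refl (≤-<-trans t≤u (<-trans (n<1+n u) lt)))
... | no _    = lt

shiftFrom-preserves-< : ∀ t u → u < t → shiftFrom t u < t
shiftFrom-preserves-< t u u<t rewrite shiftFrom-< t u u<t = u<t

-- cycleₛ m t b inserts m at position t with sign b.
cycleₛ : ℕ → ℕ → Bool → SignedMap
cycleₛ m t b x with <-cmp x m
... | tri< _ _ _ = shiftFrom t x , false
... | tri≈ _ _ _ = t , b
... | tri> _ _ _ = x , false

cycleₛ⁻¹ : ℕ → ℕ → Bool → SignedMap
cycleₛ⁻¹ m t b x with <-cmp x t
... | tri< _ _ _ = x , false
... | tri≈ _ _ _ = m , b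
... | tri> _ _ _ with x ≤? m
...   | yes _ = pred x , false
...   | no _  = x , false

cycleₛ-below : ∀ m t b x → x < m → cycleₛ m t b x ≡ (shiftFrom t x , false)
cycleₛ-below m t b x x<m with <-cmp x m
... | tri< _ _ _   = refl
... | tri≈ _ x≡m _ = ⊥-elim (<-irrefl x≡m x<m)
... | tri> _ _ x>m = ⊥-elim (<-asym x<m x>m)

cycleₛ-top : ∀ m t b → cycleₛ m t b m ≡ (t , b)
cycleₛ-top m t b with <-cmp m m
... | tri< m<m _ _ = ⊥-elim (<-irrefl refl m<m)
... | tri≈ _ _ _   = refl
... | tri> _ _ m>m = ⊥-elim (<-irrefl refl m>m)

cycleₛ-above : ∀ m t b x → m < x → cycleₛ m t b x ≡ (x , false)
cycleₛ-above m t b x m<x with <-cmp x m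
... | tri< x<m _ _ = ⊥-elim (<-asym x<m m<x)
... | tri≈ _ x≡m _ = ⊥-elim (<-irrefl (sym x≡m) m<x)
... | tri> _ _ _   = refl

cycleₛ⁻¹-below : ∀ m t b x → x < t → cycleₛ⁻¹ m t b x ≡ (x , false)
cycleₛ⁻¹-below m t b x x<t with <-cmp x t
... | tri< _ _ _   = refl
... | tri≈ _ x≡t _ = ⊥-elim (<-irrefl x≡t x<t)
... | tri> _ _ x>t = ⊥-elim (<-asym x<t x>t)

cycleₛ⁻¹-top : ∀ m t b → cycleₛ⁻¹ m t b t ≡ (m , b)
cycleₛ⁻¹-top m t b with <-cmp t t
... | tri< t<t _ _ = ⊥-elim (<-irrefl refl t<t)
... | tri≈ _ _ _   = refl
... | tri> _ _ t>t = ⊥-elim (<-irrefl refl t>t)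

cycleₛ⁻¹-between : ∀ m t b x → t < x → x ≤ m → cycleₛ⁻¹ m t b x ≡ (pred x , false)
cycleₛ⁻¹-between m t b x t<x x≤m with <-cmp x t
... | tri< x<t _ _ = ⊥-elim (<-asym x<t t<x)
... | tri≈ _ x≡t _ = ⊥-elim (<-irrefl (sym x≡t) t<x)
... | tri> _ _ _ with x ≤? m
...   | yes _   = refl
...   | no x≰m = ⊥-elim (x≰m x≤m)

cycleₛ⁻¹-above : ∀ m t b x → t < x → m < x → cycleₛ⁻¹ m t b x ≡ (x , false)
cycleₛ⁻¹-above m t b x t<x m<x with <-cmp x t
... | tri< x<t _ _ = ⊥-elim (<-asym x<t t<x)
... | tri≈ _ x≡t _ = ⊥-elim (<-irrefl (sym x≡t) t<x)
... | tri> _ _ _ with x ≤? m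
...   | yes x≤m = ⊥-elim (<-irrefl refl (<-≤-trans m<x x≤m))
...   | no _    = refl

module _ (m t : ℕ) (b : Bool) (t≤m : t ≤ m) where

  cycleₛ⁻¹∘cycleₛ : cycleₛ⁻¹ m t b ∘ₛ cycleₛ m t b ≗ idₛ
  cycleₛ⁻¹∘cycleₛ x = split (<-cmp x m) (t ≤? x)
    where
    split : Tri (x < m) (x ≡ m) (m < x) → Dec (t ≤ x) → (cycleₛ⁻¹ m t b ∘ₛ cycleₛ m t b) x ≡ (x , false)
    split (tri≈ _ refl _) _ rewrite cycleₛ-top x t b | cycleₛ⁻¹-top x t b = cong (x ,_) (xor-same b)
    split (tri> _ _ m<x) _
      rewrite cycleₛ-above m t b x m<x | cycleₛ⁻¹-above m t b x (≤-<-trans t≤m m<x) m<x = refl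
    split (tri< x<m _ _) (yes t≤x) rewrite cycleₛ-below m t b x x<m | shiftFrom-≥ t x t≤x
      | cycleₛ⁻¹-between m t b (suc x) (s≤s t≤x) x<m = refl
    split (tri< x<m _ _) (no t≰x) rewrite cycleₛ-below m t b x x<m | shiftFrom-< t x (≰⇒> t≰x)
      | cycleₛ⁻¹-below m t b x (≰⇒> t≰x) = refl

  cycleₛ∘cycleₛ⁻¹ : cycleₛ m t b ∘ₛ cycleₛ⁻¹ m t b ≗ idₛ
  cycleₛ∘cycleₛ⁻¹ x = split x (<-cmp x t) (x ≤? m)
    where
    split : ∀ x → Tri (x < t) (x ≡ t) (t < x) → Dec (x ≤ m) → (cycleₛ m t b ∘ₛ cycleₛ⁻¹ m t b) x ≡ (x , false)
    split x (tri< x<t _ _) _ rewrite cycleₛ⁻¹-below m t b x x<t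
      | cycleₛ-below m t b x (<-≤-trans x<t t≤m) | shiftFrom-< t x x<t = refl
    split x (tri≈ _ refl _) _ rewrite cycleₛ⁻¹-top m x b | cycleₛ-top m x b = cong (x ,_) (xor-same b)
    split (suc x) (tri> _ _ t<x+1) (yes x+1≤m) rewrite cycleₛ⁻¹-between m t b (suc x) t<x+1 x+1≤m
      | cycleₛ-below m t b x x+1≤m | shiftFrom-≥ t x (s≤s⁻¹ t<x+1) = refl
    split (suc x) (tri> _ _ t<x+1) (no x+1≰m) rewrite cycleₛ⁻¹-above m t b (suc x) t<x+1 (≰⇒> x+1≰m)
      | cycleₛ-above m t b (suc x) (≰⇒> x+1≰m) = refl

  cycleₛ-signedPerm : SignedPermOn (suc m) (cycleₛ m t b)
  cycleₛ-signedPerm = signedPerm-fromLeftInverse {g = cycleₛ⁻¹ m t b} image (λ x → cycleₛ-above m t b x)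
    cycleₛ⁻¹∘cycleₛ
    where
    image : ∀ x → x < suc m → proj₁ (cycleₛ m t b x) < suc m
    image x x≤m with m≤n⇒m<n∨m≡n (s≤s⁻¹ x≤m)
    ... | inj₂ refl rewrite cycleₛ-top x t b = s≤s t≤m
    ... | inj₁ x<m rewrite cycleₛ-below m t b x x<m with t ≤? x
    ...   | yes _ = s≤s x<m
    ...   | no _  = x≤m

  cycleₛ⁻¹-signedPerm : SignedPermOn (suc m) (cycleₛ⁻¹ m t b)
  cycleₛ⁻¹-signedPerm = signedPerm-fromLeftInverse {g = cycleₛ m t b} image
    (λ x m<x → cycleₛ⁻¹-above m t b x (<-≤-trans (s≤s t≤m) m<x) m<x) cycleₛ∘cycleₛ⁻¹
    where
    image : ∀ x → x < suc m → proj₁ (cycleₛ⁻¹ m t b x) < suc m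
    image x x≤m = split (<-cmp x t)
      where
      split : Tri (x < t) (x ≡ t) (t < x) → proj₁ (cycleₛ⁻¹ m t b x) < suc m
      split (tri< x<t _ _)  rewrite cycleₛ⁻¹-below m t b x x<t = x≤m
      split (tri≈ _ refl _) rewrite cycleₛ⁻¹-top m x b = ≤-refl
      split (tri> _ _ t<x)  rewrite cycleₛ⁻¹-between m t b x t<x (s≤s⁻¹ x≤m) = ≤-<-trans pred[n]≤n x≤m

bit : Bool → ℕ
bit true  = 1
bit false = 0

bit≤1 : ∀ b → bit b ≤ 1
bit≤1 true  = s≤s z≤n
bit≤1 false = z≤n

-- How many of e_r − e_j and e_r + e_j (j < r) are made negative when j ↦ x and
-- r ↦ y, with sign b at r: both if y > x and b, one if x > y, none otherwise.
pairInversions : Bool → ℕ → ℕ → ℕ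
pairInversions true  x y = suc (𝟙< x y)
pairInversions false x y = 1 ∸ 𝟙< x y

-- The number of roots in Ψ'_r = {e_r} ∪ {e_r ± e_j : j < r} that f makes negative.
invCode : SignedMap → ℕ → ℕ
invCode f r = bit (proj₂ (f r)) + Σ< r (λ j → pairInversions (proj₂ (f r)) (proj₁ (f j)) (proj₁ (f r)))

pairInversions≤2 : ∀ b x y → pairInversions b x y ≤ 2
pairInversions≤2 true  x y = s≤s (𝟙<-≤1 x y)
pairInversions≤2 false x y = ≤-trans (m∸n≤m 1 (𝟙< x y)) (s≤s z≤n)

invCode<slots : ∀ f r → invCode f r < slots r
invCode<slots f r = subst (invCode f r <_) (trans (cong (2 +_) (*-comm r 2)) (+-comm 2 (2 ℕ.* r)))
  (s≤s (+-mono-≤ (bit≤1 (proj₂ (f r)))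
    (subst (Σ< r pairs ≤_) (Σ<-const r 2) (Σ<-mono-≤ r (λ j _ → pairInversions≤2 (proj₂ (f r)) (proj₁ (f j)) (proj₁ (f r)))))))
  where
  pairs : ℕ → ℕ
  pairs j = pairInversions (proj₂ (f r)) (proj₁ (f j)) (proj₁ (f r))

invCode-cong : ∀ n f g → AgreeBelow n f g → ∀ r → r < n → invCode f r ≡ invCode g r
invCode-cong n f g agree r r<n rewrite agree r r<n =
  cong (bit (proj₂ (g r)) +_) (Σ<-cong r (λ j j<r →
    cong (λ p → pairInversions (proj₂ (g r)) (proj₁ p) (proj₁ (g r))) (agree j (<-trans j<r r<n))))

𝟙<-cong : ∀ x y x′ y′ → (x < y → x′ < y′) → (x′ < y′ → x < y) → 𝟙< x y ≡ 𝟙< x′ y′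
𝟙<-cong x y x′ y′ to from with x <? y | x′ <? y′
... | yes _   | yes _    = refl
... | no _    | no _     = refl
... | yes x<y | no x′≮y′ = ⊥-elim (x′≮y′ (to x<y))
... | no x≮y  | yes x′<y′ = ⊥-elim (x≮y (from x′<y′))

pairInversions-cong : ∀ b x y x′ y′ → (x < y → x′ < y′) → (x′ < y′ → x < y) →
  pairInversions b x y ≡ pairInversions b x′ y′
pairInversions-cong true  x y x′ y′ to from = cong suc (𝟙<-cong x y x′ y′ to from)
pairInversions-cong false x y x′ y′ to from = cong (1 ∸_) (𝟙<-cong x y x′ y′ to from)

Σ<-pairInversions : ∀ m g → SignedPermOn m g → ∀ b t → t ≤ m →
  Σ< m (λ j → pairInversions b (proj₁ (g j)) t) ≡ (if b then m + t else m ∸ t)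
Σ<-pairInversions m g pg true t t≤m =
  trans (Σ<-+ m (λ _ → 1) (λ j → 𝟙< (proj₁ (g j)) t)) (cong₂ _+_ (Σ<-ones m) (Σ<-𝟙<-signedPerm m g pg t t≤m))
Σ<-pairInversions m g pg false t t≤m = trans (sym (m+n∸n≡m _ t)) (cong (_∸ t) (begin
  Σ< m (λ j → 1 ∸ lt j) + t            ≡⟨ cong (Σ< m (λ j → 1 ∸ lt j) +_) (Σ<-𝟙<-signedPerm m g pg t t≤m) ⟨
  Σ< m (λ j → 1 ∸ lt j) + Σ< m lt      ≡⟨ Σ<-+ m (λ j → 1 ∸ lt j) lt ⟨
  Σ< m (λ j → 1 ∸ lt j + lt j)         ≡⟨ Σ<-cong m (λ j _ → m∸n+n≡m (𝟙<-≤1 (proj₁ (g j)) t)) ⟩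
  Σ< m (λ _ → 1)                       ≡⟨ Σ<-ones m ⟩
  m                                    ∎))
  where
  open ≡-Reasoning
  lt : ℕ → ℕ
  lt j = 𝟙< (proj₁ (g j)) t

-- Chosen so that inserting m at lehmerTop m k creates exactly k inversions at m
-- (lehmerTop-invCode).
lehmerTop : ℕ → ℕ → ℕ × Bool
lehmerTop m k with k ≤? m
... | yes _ = m ∸ k , false
... | no _  = k ∸ suc m , true

lehmerTop-≤ : ∀ m k → k < slots m → proj₁ (lehmerTop m k) ≤ m
lehmerTop-≤ m k k<slots with k ≤? m
... | yes _ = m∸n≤m m k
... | no _  = upper-half≤ m k k<slots

lehmerTop-invCode : ∀ m k → let (t , b) = lehmerTop m k in bit b + (if b then m + t else m ∸ t) ≡ k
lehmerTop-invCode m k with k ≤? m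
... | yes k≤m = m∸[m∸n]≡n k≤m
... | no k≰m  = m+[n∸m]≡n (≰⇒> k≰m)

lehmerTop-injective : ∀ m k k′ → lehmerTop m k ≡ lehmerTop m k′ → k ≡ k′
lehmerTop-injective m k k′ eq = trans (sym (lehmerTop-invCode m k))
  (trans (cong (λ (t , b) → bit b + (if b then m + t else m ∸ t)) eq) (lehmerTop-invCode m k′))

lehmerTop-surjective : ∀ m t b → t ≤ m → Σ[ k ∈ ℕ ] k < slots m × lehmerTop m k ≡ (t , b)
lehmerTop-surjective m t false t≤m = m ∸ t , lower<slots m _ (m∸n≤m m t) , value
  where
  value : lehmerTop m (m ∸ t) ≡ (t , false)
  value with m ∸ t ≤? m
  ... | yes _ = cong (_, false) (m∸[m∸n]≡n t≤m)
  ... | no m∸t≰m = ⊥-elim (m∸t≰m (m∸n≤m m t))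
lehmerTop-surjective m t true t≤m = suc m + t , upper<slots m t t≤m , value
  where
  value : lehmerTop m (suc m + t) ≡ (t , true)
  value with suc m + t ≤? m
  ... | yes m+1+t≤m = ⊥-elim (<-irrefl refl (≤-trans m+1+t≤m (m≤m+n m t)))
  ... | no _ = cong (_, true) (m+n∸m≡n (suc m) t)

insertionₛ : ℕ → ℕ → SignedMap
insertionₛ m k = cycleₛ m (proj₁ (lehmerTop m k)) (proj₂ (lehmerTop m k))

insertionₛ⁻¹ : ℕ → ℕ → SignedMap
insertionₛ⁻¹ m k = cycleₛ⁻¹ m (proj₁ (lehmerTop m k)) (proj₂ (lehmerTop m k))

insertionₛ-top-injective : ∀ m k k′ → k < slots m → k′ < slots m → insertionₛ m k m ≡ insertionₛ m k′ m → k ≡ k′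
insertionₛ-top-injective m k k′ _ _ eq = lehmerTop-injective m k k′
  (trans (sym (cycleₛ-top m _ _)) (trans eq (cycleₛ-top m _ _)))

insertionₛ-top-surjective : ∀ m t b → t ≤ m → Σ[ k ∈ ℕ ] k < slots m × insertionₛ m k m ≡ (t , b)
insertionₛ-top-surjective m t b t≤m with lehmerTop-surjective m t b t≤m
... | k , k<slots , top≡ = k , k<slots , trans (cycleₛ-top m _ _) top≡

module InversionTable = Factorisation insertionₛ insertionₛ⁻¹
  (λ m k k<slots → cycleₛ-signedPerm m _ _ (lehmerTop-≤ m k k<slots))
  (λ m k k<slots → cycleₛ⁻¹-signedPerm m _ _ (lehmerTop-≤ m k k<slots))
  (λ m k k<slots → cycleₛ⁻¹∘cycleₛ m _ _ (lehmerTop-≤ m k k<slots))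
  (λ m k k<slots → cycleₛ∘cycleₛ⁻¹ m _ _ (lehmerTop-≤ m k k<slots))
  insertionₛ-top-injective insertionₛ-top-surjective

∘ₛ-cycleₛ-below : ∀ m t b g → SignedPermOn m g → ∀ j → j < m →
  (cycleₛ m t b ∘ₛ g) j ≡ (shiftFrom t (proj₁ (g j)) , proj₂ (g j))
∘ₛ-cycleₛ-below m t b g pg j j<m rewrite cycleₛ-below m t b (proj₁ (g j)) (image< pg j j<m) =
  cong (shiftFrom t (proj₁ (g j)) ,_) (xor-identityʳ _)

-- Inserting m changes no relative order among the positions of 0, …, m-1.
invCode-cycleₛ-below : ∀ m t b g → SignedPermOn m g → ∀ r → r < m → invCode (cycleₛ m t b ∘ₛ g) r ≡ invCode g r
invCode-cycleₛ-below m t b g pg r r<m =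
  cong₂ _+_ (cong (bit ∘ proj₂) gr) (Σ<-cong r λ j j<r →
    trans (cong₂ (λ p q → pairInversions (proj₂ p) (proj₁ q) (proj₁ p)) gr (∘ₛ-cycleₛ-below m t b g pg j (<-trans j<r r<m)))
      (pairInversions-cong (proj₂ (g r)) _ _ (proj₁ (g j)) (proj₁ (g r)) (shiftFrom-cancel-< t _ _) (shiftFrom-mono-< t _ _)))
  where
  gr = ∘ₛ-cycleₛ-below m t b g pg r r<m

invCode-cycleₛ-top : ∀ m t b g → SignedPermOn m g →
  invCode (cycleₛ m t b ∘ₛ g) m ≡ bit b + Σ< m (λ j → pairInversions b (proj₁ (g j)) t)
invCode-cycleₛ-top m t b g pg =
  cong₂ _+_ (cong (bit ∘ proj₂) gm) (Σ<-cong m λ j j<m →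
    trans (cong₂ (λ p q → pairInversions (proj₂ p) (proj₁ q) (proj₁ p)) gm (∘ₛ-cycleₛ-below m t b g pg j j<m))
      (pairInversions-cong b _ t (proj₁ (g j)) t (shiftFrom-<-iff t _) (shiftFrom-preserves-< t _)))
  where
  gm : (cycleₛ m t b ∘ₛ g) m ≡ (t , b)
  gm = trans (∘ₛ-cong-at (cycleₛ m t b) {g} {idₛ} m (fixed≥ pg m ≤-refl)) (cycleₛ-top m t b)

invCode-inversionTable : ∀ n a → Bounded n a → ∀ r → r < n → invCode (InversionTable.prod a n) r ≡ a r
invCode-inversionTable (suc m) a bnd r r<m+1 with m<1+n⇒m<n∨m≡n r<m+1
... | inj₁ r<m  = trans (invCode-cycleₛ-below m _ _ _ pg r r<m) (invCode-inversionTable m a (bounded-pred bnd) r r<m)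
  where pg = InversionTable.prod-signedPerm m a (bounded-pred bnd)
... | inj₂ refl = begin
  invCode (insertionₛ r (a r) ∘ₛ InversionTable.prod a r) r                       ≡⟨ invCode-cycleₛ-top r t b _ pg ⟩
  bit b + Σ< r (λ j → pairInversions b (proj₁ (InversionTable.prod a r j)) t)   ≡⟨ cong (bit b +_)
                                                                  (Σ<-pairInversions r _ pg b t (lehmerTop-≤ r (a r) (bnd r ≤-refl))) ⟩
  bit b + (if b then r + t else r ∸ t)                                            ≡⟨ lehmerTop-invCode r (a r) ⟩
  a r                                                                             ∎
  where
  open ≡-Reasoning
  pg = InversionTable.prod-signedPerm r a (bounded-pred bnd)
  t = proj₁ (lehmerTop r (a r))
  b = proj₂ (lehmerTop r (a r))

⟦_⟧ : ∀ {n} → V n → SignedMap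
⟦_⟧ {n} v k with k <? n
... | yes k<n = toℕ (β v (fromℕ< k<n)) , ε v (fromℕ< k<n)
... | no _    = k , false

⟦⟧-< : ∀ {n} (v : V n) k (k<n : k < n) → ⟦ v ⟧ k ≡ (toℕ (β v (fromℕ< k<n)) , ε v (fromℕ< k<n))
⟦⟧-< {n} v k k<n with k <? n
... | yes k<n′ rewrite Finₚ.fromℕ<-cong k k refl k<n′ k<n = refl
... | no k≮n   = ⊥-elim (k≮n k<n)

⟦⟧-≥ : ∀ {n} (v : V n) k → n ≤ k → ⟦ v ⟧ k ≡ (k , false)
⟦⟧-≥ {n} v k n≤k with k <? n
... | yes k<n = ⊥-elim (<-irrefl refl (<-≤-trans k<n n≤k))
... | no _    = refl

⟦⟧-toℕ : ∀ {n} (v : V n) (i : Fin n) → ⟦ v ⟧ (toℕ i) ≡ (toℕ (β v i) , ε v i)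
⟦⟧-toℕ v i rewrite ⟦⟧-< v (toℕ i) (Finₚ.toℕ<n i) | Finₚ.fromℕ<-toℕ i (Finₚ.toℕ<n i) = refl

lookup-ext : ∀ {A : Set} {n} (xs ys : Vec A n) → (∀ i → lookup xs i ≡ lookup ys i) → xs ≡ ys
lookup-ext xs ys eq = trans (sym (Vecₚ.tabulate∘lookup xs)) (trans (Vecₚ.tabulate-cong eq) (Vecₚ.tabulate∘lookup ys))

⟦⟧-injective : ∀ {n} (v w : V n) → AgreeBelow n ⟦ v ⟧ ⟦ w ⟧ → v ≡ w
⟦⟧-injective v w agree = lookup-ext v w λ i →
  let eq = trans (sym (⟦⟧-toℕ v i)) (trans (agree (toℕ i) (Finₚ.toℕ<n i)) (⟦⟧-toℕ w i))
  in ×-≡,≡→≡ (Finₚ.toℕ-injective (cong proj₁ eq) , cong proj₂ eq)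

⟦∘B⟧ : ∀ {n} (u w : V n) → ⟦ u ∘B w ⟧ ≗ ⟦ u ⟧ ∘ₛ ⟦ w ⟧
⟦∘B⟧ {n} u w k = split (k <? n)
  where
  split : Dec (k < n) → ⟦ u ∘B w ⟧ k ≡ (⟦ u ⟧ ∘ₛ ⟦ w ⟧) k
  split (yes k<n) rewrite ⟦⟧-< (u ∘B w) k k<n | ⟦⟧-< w k k<n | ⟦⟧-toℕ u (β w (fromℕ< k<n))
    | Vecₚ.lookup∘tabulate (λ k → β u (β w k) , (ε w k xor ε u (β w k))) (fromℕ< k<n) = refl
  split (no k≮n) rewrite ⟦⟧-≥ (u ∘B w) k (≮⇒≥ k≮n) | ⟦⟧-≥ w k (≮⇒≥ k≮n) | ⟦⟧-≥ u k (≮⇒≥ k≮n) = refl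

⟦idB⟧ : ∀ {n} → ⟦ idB {n} ⟧ ≗ idₛ
⟦idB⟧ {n} k = split (k <? n)
  where
  split : Dec (k < n) → ⟦ idB {n} ⟧ k ≡ idₛ k
  split (yes k<n) rewrite ⟦⟧-< (idB {n}) k k<n | Vecₚ.lookup∘tabulate {n = n} (λ k → k , false) (fromℕ< k<n)
    | Finₚ.toℕ-fromℕ< k<n = refl
  split (no k≮n) = ⟦⟧-≥ idB k (≮⇒≥ k≮n)

⟦^B⟧ : ∀ {n} (v : V n) k → ⟦ v ^B k ⟧ ≗ ⟦ v ⟧ ^ₛ k
⟦^B⟧ v zero    = ⟦idB⟧
⟦^B⟧ v (suc k) x = trans (⟦∘B⟧ v (v ^B k) x) (∘ₛ-congʳ ⟦ v ⟧ (⟦^B⟧ v k) x)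

all-intro : ∀ {A : Set} (p : A → Bool) xs → (∀ x → p x ≡ true) → BoolList.all p xs ≡ true
all-intro p []       _ = refl
all-intro p (x ∷ xs) h rewrite h x = all-intro p xs h

all-elim : ∀ {A : Set} (p : A → Bool) xs → BoolList.all p xs ≡ true → ∀ {x} → x ∈ xs → p x ≡ true
all-elim p (y ∷ xs) eq (here refl) with p y
... | true = refl
all-elim p (y ∷ xs) eq (there x∈xs) with p y
... | true = all-elim p xs eq x∈xs

InB⇒β-injective : ∀ {n} (v : V n) → InB v → ∀ i j → β v i ≡ β v j → i ≡ j
InB⇒β-injective {n} v inB i j βi≡βj = decide (i Fin.≟ j) (β v i Fin.≟ β v j) pair-ok
  where
  pair-ok : (not ⌊ β v i Fin.≟ β v j ⌋ ∨ ⌊ i Fin.≟ j ⌋) ≡ true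
  pair-ok = all-elim _ (allFin n) (all-elim _ (allFin n) inB (∈-allFin i)) (∈-allFin j)
  decide : (i≟j : Dec (i ≡ j)) (βi≟βj : Dec (β v i ≡ β v j)) → (not ⌊ βi≟βj ⌋ ∨ ⌊ i≟j ⌋) ≡ true → i ≡ j
  decide (yes i≡j) _ _ = i≡j
  decide (no _) (no βi≢βj) _ = ⊥-elim (βi≢βj βi≡βj)

β-injective⇒InB : ∀ {n} (v : V n) → (∀ i j → β v i ≡ β v j → i ≡ j) → InB v
β-injective⇒InB {n} v inj = all-intro _ (allFin n) λ i → all-intro _ (allFin n) λ j →
  pair-ok i j (i Fin.≟ j) (β v i Fin.≟ β v j)
  where
  pair-ok : ∀ i j (i≟j : Dec (i ≡ j)) (βi≟βj : Dec (β v i ≡ β v j)) → (not ⌊ βi≟βj ⌋ ∨ ⌊ i≟j ⌋) ≡ true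
  pair-ok i j (yes _)   βi≟βj      = ∨-zeroʳ _
  pair-ok i j (no i≢j) (yes βi≡βj) = ⊥-elim (i≢j (inj i j βi≡βj))
  pair-ok i j (no _)   (no _)      = refl

InB⇒signedPerm : ∀ {n} (v : V n) → InB v → SignedPermOn n ⟦ v ⟧
InB⇒signedPerm {n} v inB = record { image< = image ; injective = inj ; fixed≥ = ⟦⟧-≥ v }
  where
  image : ∀ k → k < n → proj₁ (⟦ v ⟧ k) < n
  image k k<n rewrite ⟦⟧-< v k k<n = Finₚ.toℕ<n _
  inj : ∀ j k → j < n → k < n → proj₁ (⟦ v ⟧ j) ≡ proj₁ (⟦ v ⟧ k) → j ≡ k
  inj j k j<n k<n eq rewrite ⟦⟧-< v j j<n | ⟦⟧-< v k k<n =
    trans (sym (Finₚ.toℕ-fromℕ< j<n))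
      (trans (cong toℕ (InB⇒β-injective v inB _ _ (Finₚ.toℕ-injective eq))) (Finₚ.toℕ-fromℕ< k<n))

signedPerm⇒InB : ∀ {n} (v : V n) (f : SignedMap) → SignedPermOn n f → AgreeBelow n ⟦ v ⟧ f → InB v
signedPerm⇒InB {n} v f pf agree = β-injective⇒InB v λ i j βi≡βj →
  Finₚ.toℕ-injective (injective pf (toℕ i) (toℕ j) (Finₚ.toℕ<n i) (Finₚ.toℕ<n j)
    (trans (sym (position i)) (trans (cong toℕ βi≡βj) (position j))))
  where
  position : ∀ i → toℕ (β v i) ≡ proj₁ (f (toℕ i))
  position i = cong proj₁ (trans (sym (⟦⟧-toℕ v i)) (agree _ (Finₚ.toℕ<n i)))

fromSignedMap : ∀ {n} (f : SignedMap) → (∀ k → k < n → proj₁ (f k) < n) → V n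
fromSignedMap f image = tabulate (λ i → fromℕ< (image (toℕ i) (Finₚ.toℕ<n i)) , proj₂ (f (toℕ i)))

⟦fromSignedMap⟧ : ∀ {n} (f : SignedMap) (image : ∀ k → k < n → proj₁ (f k) < n) →
  AgreeBelow n ⟦ fromSignedMap f image ⟧ f
⟦fromSignedMap⟧ f image k k<n rewrite ⟦⟧-< (fromSignedMap f image) k k<n
  | Vecₚ.lookup∘tabulate (λ i → fromℕ< (image (toℕ i) (Finₚ.toℕ<n i)) , proj₂ (f (toℕ i))) (fromℕ< k<n)
  = ×-≡,≡→≡ (trans (Finₚ.toℕ-fromℕ< _) (cong (proj₁ ∘ f) k≡) , cong (proj₂ ∘ f) k≡)
  where k≡ = Finₚ.toℕ-fromℕ< k<n

⟦t₁⟧ : ∀ {m} → ⟦ t₁ {suc m} ⟧ ≗ σₛ 0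
⟦t₁⟧ {m} k = split (k <? suc m)
  where
  split : Dec (k < suc m) → ⟦ t₁ {suc m} ⟧ k ≡ σₛ 0 k
  split (yes k<n) rewrite ⟦⟧-< (t₁ {suc m}) k k<n
    | Vecₚ.lookup∘tabulate (λ k → k , ⌊ toℕ k ≟ 0 ⌋) (fromℕ< k<n) | Finₚ.toℕ-fromℕ< k<n = t₁-values k
    where
    t₁-values : ∀ k → (k , ⌊ k ≟ 0 ⌋) ≡ σₛ 0 k
    t₁-values zero    = refl
    t₁-values (suc k) = refl
  split (no k≮n) rewrite ⟦⟧-≥ (t₁ {suc m}) k (≮⇒≥ k≮n) = t₁-fixed k (≮⇒≥ k≮n)
    where
    t₁-fixed : ∀ k → suc m ≤ k → (k , false) ≡ σₛ 0 k
    t₁-fixed (suc k) _ = refl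

swapₛ : ℕ → SignedMap
swapₛ i k with k ≟ i
... | yes _ = suc i , false
... | no _ with k ≟ suc i
...   | yes _ = i , false
...   | no _  = k , false

swapₛ-unsigned : ∀ i k → proj₂ (swapₛ i k) ≡ false
swapₛ-unsigned i k with k ≟ i
... | yes _ = refl
... | no _ with k ≟ suc i
...   | yes _ = refl
...   | no _  = refl

swapₛ-above : ∀ i k → suc i < k → swapₛ i k ≡ (k , false)
swapₛ-above i k i+1<k with k ≟ i
... | yes refl = ⊥-elim (<-asym i+1<k (n<1+n k))
... | no _ with k ≟ suc i
...   | yes refl = ⊥-elim (<-irrefl refl i+1<k)
...   | no _     = refl

toℕ-swapIdx : ∀ {m} (p : Fin m) (k : Fin (suc m)) → toℕ (swapIdx p k) ≡ proj₁ (swapₛ (toℕ p) (toℕ k))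
toℕ-swapIdx p k with k Fin.≟ inject₁ p | toℕ k ≟ toℕ p
... | yes refl | yes _     = refl
... | yes refl | no k≢p    = ⊥-elim (k≢p (Finₚ.toℕ-inject₁ p))
... | no k≢p   | yes k≡p   = ⊥-elim (k≢p (Finₚ.toℕ-injective (trans k≡p (sym (Finₚ.toℕ-inject₁ p)))))
... | no _     | no _ with k Fin.≟ Fin.suc p | toℕ k ≟ suc (toℕ p)
...   | yes refl | yes _       = Finₚ.toℕ-inject₁ p
...   | yes refl | no k≢p+1    = ⊥-elim (k≢p+1 refl)
...   | no k≢p+1 | yes k≡p+1   = ⊥-elim (k≢p+1 (Finₚ.toℕ-injective k≡p+1))
...   | no _     | no _        = refl

⟦s⟧ : ∀ {m} (p : Fin m) → ⟦ s p ⟧ ≗ swapₛ (toℕ p)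
⟦s⟧ {m} p k = split (k <? suc m)
  where
  split : Dec (k < suc m) → ⟦ s p ⟧ k ≡ swapₛ (toℕ p) k
  split (yes k<n) rewrite ⟦⟧-< (s p) k k<n | Vecₚ.lookup∘tabulate (λ k → swapIdx p k , false) (fromℕ< k<n) =
    ×-≡,≡→≡ (trans (toℕ-swapIdx p (fromℕ< k<n)) (cong (proj₁ ∘ swapₛ (toℕ p)) (Finₚ.toℕ-fromℕ< k<n))
            , sym (swapₛ-unsigned (toℕ p) k))
  split (no k≮n) rewrite ⟦⟧-≥ (s p) k (≮⇒≥ k≮n) =
    sym (swapₛ-above (toℕ p) k (<-≤-trans (s≤s (Finₚ.toℕ<n p)) (≮⇒≥ k≮n)))

sℕ-lookup : ∀ {m} i (q : Fin m) (ps : List (Fin m)) → toℕ q ≡ i → q ∈ ps →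
  List.foldr (λ p r → if toℕ p ≡ᵇ i then s p else r) idB ps ≡ s q
sℕ-lookup i q (p ∷ ps) q≡i q∈ with toℕ p ≡ᵇ i in p≡ᵇi
... | true = cong s (Finₚ.toℕ-injective (trans (≡ᵇ⇒≡ (toℕ p) i (Equivalence.from T-≡ p≡ᵇi)) (sym q≡i)))
sℕ-lookup i q (p ∷ ps) q≡i (here refl)  | false = ⊥-elim (subst T p≡ᵇi (≡⇒≡ᵇ (toℕ p) i q≡i))
sℕ-lookup i q (p ∷ ps) q≡i (there q∈ps) | false = sℕ-lookup i q ps q≡i q∈ps

⟦sℕ⟧ : ∀ {m} i → i < m → ⟦ sℕ {m} i ⟧ ≗ swapₛ i
⟦sℕ⟧ {m} i i<m k rewrite sℕ-lookup i (fromℕ< i<m) (allFin m) (Finₚ.toℕ-fromℕ< i<m) (∈-allFin _) =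
  trans (⟦s⟧ (fromℕ< i<m) k) (cong (λ j → swapₛ j k) (Finₚ.toℕ-fromℕ< i<m))

σₛ-suc : ∀ i → σₛ (suc i) ≗ swapₛ i ∘ₛ σₛ i
σₛ-suc i zero with i ≟ i
... | yes _  = refl
... | no i≢i = ⊥-elim (i≢i refl)
σₛ-suc i (suc k) with k <? i
σₛ-suc i (suc k) | yes k<i with k <? suc i
... | no k≮i+1 = ⊥-elim (k≮i+1 (m<n⇒m<1+n k<i))
... | yes _ with k ≟ i
...   | yes refl = ⊥-elim (<-irrefl refl k<i)
...   | no _ with k ≟ suc i
...     | yes refl = ⊥-elim (<-asym k<i (n<1+n i))
...     | no _     = refl
σₛ-suc i (suc k) | no k≮i with k <? suc i
... | yes k<i+1 with suc k ≟ i
...   | yes refl = ⊥-elim (k≮i (n<1+n k))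
...   | no _ with suc k ≟ suc i
...     | yes refl   = refl
...     | no k+1≢i+1 = ⊥-elim (k+1≢i+1 (cong suc (≤∧≮⇒≡ (s≤s⁻¹ k<i+1) k≮i)))
σₛ-suc i (suc k) | no k≮i | no k≮i+1 with suc k ≟ i
...   | yes refl = ⊥-elim (k≮i (n<1+n k))
...   | no _ with suc k ≟ suc i
...     | yes refl = ⊥-elim (k≮i+1 (n<1+n k))
...     | no _     = refl

⟦σℕ⟧ : ∀ {m} i → i ≤ m → ⟦ σℕ {m} i ⟧ ≗ σₛ i
⟦σℕ⟧ zero _ = ⟦t₁⟧
⟦σℕ⟧ {m} (suc i) i<m x = begin
  ⟦ sℕ i ∘B σℕ i ⟧ x          ≡⟨ ⟦∘B⟧ (sℕ i) (σℕ i) x ⟩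
  (⟦ sℕ i ⟧ ∘ₛ ⟦ σℕ i ⟧) x    ≡⟨ ∘ₛ-congˡ ⟦ σℕ {m} i ⟧ (⟦sℕ⟧ i i<m) x ⟩
  (swapₛ i ∘ₛ ⟦ σℕ i ⟧) x     ≡⟨ ∘ₛ-congʳ (swapₛ i) (⟦σℕ⟧ i (<⇒≤ i<m)) x ⟩
  (swapₛ i ∘ₛ σₛ i) x         ≡⟨ σₛ-suc i x ⟨
  σₛ (suc i) x                ∎
  where open ≡-Reasoning

extend : ∀ {n} → (Fin n → ℕ) → ℕ → ℕ
extend {n} a k with k <? n
... | yes k<n = a (fromℕ< k<n)
... | no _    = 0

extend-toℕ : ∀ {n} (a : Fin n → ℕ) i → extend a (toℕ i) ≡ a i
extend-toℕ {n} a i with toℕ i <? n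
... | yes i<n = cong a (Finₚ.fromℕ<-toℕ i i<n)
... | no i≮n  = ⊥-elim (i≮n (Finₚ.toℕ<n i))

extend-< : ∀ {n} (a : Fin n → ℕ) k (k<n : k < n) → extend a k ≡ a (fromℕ< k<n)
extend-< {n} a k k<n = trans (cong (extend a) (sym (Finₚ.toℕ-fromℕ< k<n))) (extend-toℕ a (fromℕ< k<n))

⟦σ^⟧ : ∀ {m} (i : Fin (suc m)) k → ⟦ σ i ^B k ⟧ ≗ σₛ (toℕ i) ^ₛ k
⟦σ^⟧ i k x = trans (⟦^B⟧ (σ i) k x) (^ₛ-cong (⟦σℕ⟧ (toℕ i) (s≤s⁻¹ (Finₚ.toℕ<n i))) k x)

⟦foldl-σ⟧ : ∀ {m} (a : Fin (suc m) → ℕ) l off (f : Fin l → Fin (suc m)) (acc : V (suc m)) →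
  (∀ x → toℕ (f x) ≡ off + toℕ x) → ⟦ acc ⟧ ≗ FlagNormalForm.prod (extend a) off →
  ⟦ List.foldl (λ acc i → (σ i ^B a i) ∘B acc) acc (List.tabulate f) ⟧ ≗ FlagNormalForm.prod (extend a) (off + l)
⟦foldl-σ⟧ a zero off f acc _ ⟦acc⟧≗ rewrite +-identityʳ off = ⟦acc⟧≗
⟦foldl-σ⟧ a (suc l) off f acc f≡ ⟦acc⟧≗ rewrite +-suc off l =
  ⟦foldl-σ⟧ a l (suc off) (f ∘ Fin.suc) ((σ (f Fin.zero) ^B a (f Fin.zero)) ∘B acc)
    (λ x → trans (f≡ (Fin.suc x)) (+-suc off (toℕ x))) step
  where
  x₀ = f Fin.zero
  x₀≡off : toℕ x₀ ≡ off
  x₀≡off = trans (f≡ Fin.zero) (+-identityʳ off)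
  step : ⟦ (σ x₀ ^B a x₀) ∘B acc ⟧ ≗ FlagNormalForm.prod (extend a) (suc off)
  step y = begin
    ⟦ (σ x₀ ^B a x₀) ∘B acc ⟧ y
        ≡⟨ ⟦∘B⟧ (σ x₀ ^B a x₀) acc y ⟩
    (⟦ σ x₀ ^B a x₀ ⟧ ∘ₛ ⟦ acc ⟧) y
        ≡⟨ ∘ₛ-congʳ ⟦ σ x₀ ^B a x₀ ⟧ ⟦acc⟧≗ y ⟩
    (⟦ σ x₀ ^B a x₀ ⟧ ∘ₛ FlagNormalForm.prod (extend a) off) y
        ≡⟨ ∘ₛ-congˡ (FlagNormalForm.prod (extend a) off) (⟦σ^⟧ x₀ (a x₀)) y ⟩
    (σₛ (toℕ x₀) ^ₛ a x₀ ∘ₛ FlagNormalForm.prod (extend a) off) y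
        ≡⟨ cong₂ (λ i k → (σₛ i ^ₛ k ∘ₛ FlagNormalForm.prod (extend a) off) y) x₀≡off
                 (trans (sym (extend-toℕ a x₀)) (cong (extend a) x₀≡off)) ⟩
    FlagNormalForm.prod (extend a) (suc off) y                   ∎
    where open ≡-Reasoning

⟦σprod⟧ : ∀ {m} (a : Fin (suc m) → ℕ) → ⟦ σprod {m} a ⟧ ≗ FlagNormalForm.prod (extend a) (suc m)
⟦σprod⟧ {m} a = ⟦foldl-σ⟧ a (suc m) 0 (λ x → x) idB (λ _ → refl) ⟦idB⟧

δ : ∀ {n} → Fin n → Fin n → ℤ
δ t b = if ⌊ t Fin.≟ b ⌋ then 1ℤ else 0ℤ

lookup-e : ∀ {n} (b t : Fin n) → lookup (e b) t ≡ δ t b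
lookup-e b t = Vecₚ.lookup∘tabulate (λ j → if ⌊ j Fin.≟ b ⌋ then 1ℤ else 0ℤ) t

δ-refl : ∀ {n} (a : Fin n) → δ a a ≡ 1ℤ
δ-refl a with a Fin.≟ a
... | yes _  = refl
... | no a≢a = ⊥-elim (a≢a refl)

δ-≢ : ∀ {n} (t a : Fin n) → t ≢ a → δ t a ≡ 0ℤ
δ-≢ t a t≢a with t Fin.≟ a
... | yes t≡a = ⊥-elim (t≢a t≡a)
... | no _    = refl

δ-< : ∀ {n} (t a : Fin n) → toℕ a < toℕ t → δ t a ≡ 0ℤ
δ-< t a a<t = δ-≢ t a (λ t≡a → <-irrefl (cong toℕ (sym t≡a)) a<t)

lookup-negZ : ∀ {n} (y : Zn n) t → lookup (negZ y) t ≡ ℤ.- lookup y t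
lookup-negZ y t = Vecₚ.lookup-map t ℤ.-_ y

lookup-⊖ : ∀ {n} (x y : Zn n) t → lookup (x ⊖ y) t ≡ lookup x t ℤ.- lookup y t
lookup-⊖ x y t = Vecₚ.lookup-zipWith ℤ._-_ t x y

lookup-⊕ : ∀ {n} (x y : Zn n) t → lookup (x ⊕ y) t ≡ lookup x t ℤ.+ lookup y t
lookup-⊕ x y t = Vecₚ.lookup-zipWith ℤ._+_ t x y

-- Every root is ± a positive root whose last nonzero coordinate is 1, so
-- membership in Ψ⁻ is decided by the sign of the last nonzero coordinate.
LastEntry : ∀ {n} → ℤ → Zn n → Set
LastEntry {n} c x = Σ[ a ∈ Fin n ] lookup x a ≡ c × (∀ t → toℕ a < toℕ t → lookup x t ≡ 0ℤ)

lastEntry-unique : ∀ {n} (x : Zn n) → LastEntry 1ℤ x → LastEntry -1ℤ x → ⊥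
lastEntry-unique x (a , xa≡1 , above-a) (b , xb≡-1 , above-b) with <-cmp (toℕ a) (toℕ b)
... | tri< a<b _ _ with () ← trans (sym xb≡-1) (above-a b a<b)
... | tri≈ _ a≡b _ with () ← trans (sym xa≡1) (trans (cong (lookup x) (Finₚ.toℕ-injective a≡b)) xb≡-1)
... | tri> _ _ b<a with () ← trans (sym xa≡1) (above-b a b<a)

lastEntry-negZ : ∀ {n} (y : Zn n) → LastEntry 1ℤ y → LastEntry -1ℤ (negZ y)
lastEntry-negZ y (a , ya≡1 , above-a) = a , trans (lookup-negZ y a) (cong ℤ.-_ ya≡1) ,
  λ t a<t → trans (lookup-negZ y t) (cong ℤ.-_ (above-a t a<t))

lastEntry-e : ∀ {n} (l : Fin n) → LastEntry 1ℤ (e l)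
lastEntry-e l = l , trans (lookup-e l l) (δ-refl l) , λ t l<t → trans (lookup-e l t) (δ-< t l l<t)

lastEntry-e⊖e : ∀ {n} (j i : Fin n) → toℕ i < toℕ j → LastEntry 1ℤ (e j ⊖ e i)
lastEntry-e⊖e j i i<j = j , at-j , above-j
  where
  at-j : lookup (e j ⊖ e i) j ≡ 1ℤ
  at-j rewrite lookup-⊖ (e j) (e i) j | lookup-e j j | lookup-e i j | δ-refl j | δ-< j i i<j = refl
  above-j : ∀ t → toℕ j < toℕ t → lookup (e j ⊖ e i) t ≡ 0ℤ
  above-j t j<t rewrite lookup-⊖ (e j) (e i) t | lookup-e j t | lookup-e i t
    | δ-< t j j<t | δ-< t i (<-trans i<j j<t) = refl

lastEntry-e⊕e : ∀ {n} (j i : Fin n) → toℕ i < toℕ j → LastEntry 1ℤ (e j ⊕ e i)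
lastEntry-e⊕e j i i<j = j , at-j , above-j
  where
  at-j : lookup (e j ⊕ e i) j ≡ 1ℤ
  at-j rewrite lookup-⊕ (e j) (e i) j | lookup-e j j | lookup-e i j | δ-refl j | δ-< j i i<j = refl
  above-j : ∀ t → toℕ j < toℕ t → lookup (e j ⊕ e i) t ≡ 0ℤ
  above-j t j<t rewrite lookup-⊕ (e j) (e i) t | lookup-e j t | lookup-e i t
    | δ-< t j j<t | δ-< t i (<-trans i<j j<t) = refl

Ψ⁺-lastEntry : ∀ {n} (y : Zn n) → y ∈ Ψ⁺ n → LastEntry 1ℤ y
Ψ⁺-lastEntry {n} y y∈Ψ⁺ with ∈-++⁻ (List.map e (allFin n)) y∈Ψ⁺
... | inj₁ y∈e with ∈-map⁻ e y∈e
...   | l , _ , refl = lastEntry-e l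
Ψ⁺-lastEntry {n} y y∈Ψ⁺ | inj₂ y∈pairs with satisfied (∈-concatMap⁻ _ {xs = allFin n} y∈pairs)
... | j , y∈pairs-j with satisfied (∈-concatMap⁻ _ {xs = allFin n} y∈pairs-j)
...   | i , y∈pair with toℕ i <ᵇ toℕ j in i<ᵇj
...     | true with y∈pair
...       | here refl         = lastEntry-e⊖e j i (<ᵇ⇒< (toℕ i) (toℕ j) (Equivalence.from T-≡ i<ᵇj))
...       | there (here refl) = lastEntry-e⊕e j i (<ᵇ⇒< (toℕ i) (toℕ j) (Equivalence.from T-≡ i<ᵇj))
Ψ⁺-lastEntry {n} y y∈Ψ⁺ | inj₂ _ | j , _ | i , () | false

e∈Ψ⁺ : ∀ {n} (a : Fin n) → e a ∈ Ψ⁺ n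
e∈Ψ⁺ {n} a = ∈-++⁺ˡ (∈-map⁺ e (∈-allFin a))

e±e∈Ψ⁺ : ∀ {n} (a b : Fin n) → toℕ b < toℕ a → (e a ⊖ e b) ∈ Ψ⁺ n × (e a ⊕ e b) ∈ Ψ⁺ n
e±e∈Ψ⁺ {n} a b b<a = pair∈Ψ⁺ (here refl) , pair∈Ψ⁺ (there (here refl))
  where
  pair∈Ψ⁺ : ∀ {z} → z ∈ (e a ⊖ e b) ∷ (e a ⊕ e b) ∷ [] → z ∈ Ψ⁺ n
  pair∈Ψ⁺ {z} z∈pair = ∈-++⁺ʳ (List.map e (allFin n))
    (∈-concatMap⁺ _ (lose (∈-allFin a) (∈-concatMap⁺ _ (lose (∈-allFin b)
      (subst (λ c → z ∈ (if c then (e a ⊖ e b) ∷ (e a ⊕ e b) ∷ [] else []))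
        (sym (Equivalence.to T-≡ (<⇒<ᵇ b<a))) z∈pair)))))

any-intro : ∀ {A : Set} (p : A → Bool) {x} xs → x ∈ xs → p x ≡ true → BoolList.any p xs ≡ true
any-intro p (y ∷ xs) (here refl) px≡true rewrite px≡true = refl
any-intro p (y ∷ xs) (there x∈xs) px≡true rewrite any-intro p xs x∈xs px≡true = ∨-zeroʳ (p y)

any-elim : ∀ {A : Set} (p : A → Bool) xs → BoolList.any p xs ≡ true → Σ[ x ∈ A ] x ∈ xs × p x ≡ true
any-elim p (y ∷ xs) any≡true with p y in py
... | true  = y , here refl , py
... | false = let (x , x∈xs , px) = any-elim p xs any≡true in x , there x∈xs , px

∈ᵇΨ⁻-intro : ∀ {n} (x y : Zn n) → y ∈ Ψ⁺ n → negZ y ≡ x → x ∈ᵇ Ψ⁻ n ≡ true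
∈ᵇΨ⁻-intro {n} x y y∈Ψ⁺ -y≡x =
  any-intro _ (Ψ⁻ n) (∈-map⁺ negZ y∈Ψ⁺) (trans (isYes≗does -y≟x) (dec-true -y≟x -y≡x))
  where -y≟x = Vecₚ.≡-dec ℤ._≟_ (negZ y) x

∈ᵇΨ⁻-lastEntry : ∀ {n} (x : Zn n) → LastEntry 1ℤ x → x ∈ᵇ Ψ⁻ n ≡ false
∈ᵇΨ⁻-lastEntry {n} x last with x ∈ᵇ Ψ⁻ n in x∈ᵇΨ⁻
... | false = refl
... | true with any-elim _ (Ψ⁻ n) x∈ᵇΨ⁻
...   | z , z∈Ψ⁻ , z≟x with ∈-map⁻ negZ z∈Ψ⁻
...     | y , y∈Ψ⁺ , refl with Vecₚ.≡-dec ℤ._≟_ (negZ y) x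
...       | yes refl = ⊥-elim (lastEntry-unique x last (lastEntry-negZ y (Ψ⁺-lastEntry y y∈Ψ⁺)))

sgn-δ : ∀ {n} b (t a : Fin n) → sgn b ℤ.* δ t a ≡ (if b then ℤ.- δ t a else δ t a)
sgn-δ true  t a with t Fin.≟ a
... | yes _ = refl
... | no _  = refl
sgn-δ false t a = ℤₚ.*-identityˡ (δ t a)

∈ᵇΨ⁻-±e : ∀ {n} (x : Zn n) (a : Fin n) (b : Bool) → (∀ t → lookup x t ≡ sgn b ℤ.* δ t a) → x ∈ᵇ Ψ⁻ n ≡ b
∈ᵇΨ⁻-±e x a true x≡ = ∈ᵇΨ⁻-intro x (e a) (e∈Ψ⁺ a) (lookup-ext _ _ λ t →
  trans (lookup-negZ (e a) t) (trans (cong ℤ.-_ (lookup-e a t)) (sym (trans (x≡ t) (sgn-δ true t a)))))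
∈ᵇΨ⁻-±e x a false x≡ = ∈ᵇΨ⁻-lastEntry x (a , trans (x≡ a) (cong (1ℤ ℤ.*_) (δ-refl a)) ,
  λ t a<t → trans (x≡ t) (cong (1ℤ ℤ.*_) (δ-< t a a<t)))

∈ᵇΨ⁻-±e±e : ∀ {n} (x : Zn n) (a b : Fin n) (sa sb : Bool) → toℕ b < toℕ a →
  (∀ t → lookup x t ≡ sgn sa ℤ.* δ t a ℤ.+ sgn sb ℤ.* δ t b) → x ∈ᵇ Ψ⁻ n ≡ sa
∈ᵇΨ⁻-±e±e x a b true false b<a x≡ = ∈ᵇΨ⁻-intro x (e a ⊖ e b) (proj₁ (e±e∈Ψ⁺ a b b<a)) (lookup-ext _ _ λ t → begin
  lookup (negZ (e a ⊖ e b)) t                  ≡⟨ trans (lookup-negZ (e a ⊖ e b) t) (cong ℤ.-_ (lookup-⊖ (e a) (e b) t)) ⟩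
  ℤ.- (lookup (e a) t ℤ.- lookup (e b) t)      ≡⟨ cong₂ (λ p q → ℤ.- (p ℤ.- q)) (lookup-e a t) (lookup-e b t) ⟩
  ℤ.- (δ t a ℤ.- δ t b)                        ≡⟨ ℤₚ.neg-distrib-+ (δ t a) (ℤ.- δ t b) ⟩
  ℤ.- δ t a ℤ.+ ℤ.- ℤ.- δ t b                  ≡⟨ cong (λ z → ℤ.- δ t a ℤ.+ z) (ℤₚ.neg-involutive (δ t b)) ⟩
  ℤ.- δ t a ℤ.+ δ t b                          ≡⟨ cong₂ ℤ._+_ (sgn-δ true t a) (sgn-δ false t b) ⟨
  sgn true ℤ.* δ t a ℤ.+ sgn false ℤ.* δ t b   ≡⟨ x≡ t ⟨
  lookup x t                                   ∎)
  where open ≡-Reasoning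
∈ᵇΨ⁻-±e±e x a b true true b<a x≡ = ∈ᵇΨ⁻-intro x (e a ⊕ e b) (proj₂ (e±e∈Ψ⁺ a b b<a)) (lookup-ext _ _ λ t → begin
  lookup (negZ (e a ⊕ e b)) t                  ≡⟨ trans (lookup-negZ (e a ⊕ e b) t) (cong ℤ.-_ (lookup-⊕ (e a) (e b) t)) ⟩
  ℤ.- (lookup (e a) t ℤ.+ lookup (e b) t)      ≡⟨ cong₂ (λ p q → ℤ.- (p ℤ.+ q)) (lookup-e a t) (lookup-e b t) ⟩
  ℤ.- (δ t a ℤ.+ δ t b)                        ≡⟨ ℤₚ.neg-distrib-+ (δ t a) (δ t b) ⟩
  ℤ.- δ t a ℤ.+ ℤ.- δ t b                      ≡⟨ cong₂ ℤ._+_ (sgn-δ true t a) (sgn-δ true t b) ⟨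
  sgn true ℤ.* δ t a ℤ.+ sgn true ℤ.* δ t b    ≡⟨ x≡ t ⟨
  lookup x t                                   ∎)
  where open ≡-Reasoning
∈ᵇΨ⁻-±e±e x a b false sb b<a x≡ = ∈ᵇΨ⁻-lastEntry x (a , at-a , above-a)
  where
  at-a : lookup x a ≡ 1ℤ
  at-a rewrite x≡ a | δ-refl a | δ-< a b b<a | ℤₚ.*-zeroʳ (sgn sb) = refl
  above-a : ∀ t → toℕ a < toℕ t → lookup x t ≡ 0ℤ
  above-a t a<t rewrite x≡ t | δ-< t a a<t | δ-< t b (<-trans b<a a<t) | ℤₚ.*-zeroʳ (sgn sb) = refl

sumℤ : List ℤ → ℤ
sumℤ = List.foldr ℤ._+_ 0ℤ

sumℤ-zero : ∀ {n} (g : Fin n → ℤ) → (∀ k → g k ≡ 0ℤ) → sumℤ (List.tabulate g) ≡ 0ℤ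
sumℤ-zero {zero}  g zeros = refl
sumℤ-zero {suc n} g zeros rewrite zeros Fin.zero | sumℤ-zero (g ∘ Fin.suc) (zeros ∘ Fin.suc) = refl

sumℤ-single : ∀ {n} (g : Fin n → ℤ) r → (∀ k → k ≢ r → g k ≡ 0ℤ) → sumℤ (List.tabulate g) ≡ g r
sumℤ-single {suc n} g Fin.zero zeros
  rewrite sumℤ-zero (g ∘ Fin.suc) (λ k → zeros (Fin.suc k) (λ ())) = ℤₚ.+-identityʳ (g Fin.zero)
sumℤ-single {suc n} g (Fin.suc r) zeros rewrite zeros Fin.zero (λ ()) =
  trans (ℤₚ.+-identityˡ _) (sumℤ-single (g ∘ Fin.suc) r (λ k k≢r → zeros (Fin.suc k) (k≢r ∘ Finₚ.suc-injective)))

sumℤ-pair : ∀ {n} (g : Fin n → ℤ) r j → r ≢ j → (∀ k → k ≢ r → k ≢ j → g k ≡ 0ℤ) →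
  sumℤ (List.tabulate g) ≡ g r ℤ.+ g j
sumℤ-pair {suc n} g Fin.zero    Fin.zero    r≢j zeros = ⊥-elim (r≢j refl)
sumℤ-pair {suc n} g Fin.zero    (Fin.suc j) _   zeros = cong (λ z → g Fin.zero ℤ.+ z)
  (sumℤ-single (g ∘ Fin.suc) j (λ k k≢j → zeros (Fin.suc k) (λ ()) (k≢j ∘ Finₚ.suc-injective)))
sumℤ-pair {suc n} g (Fin.suc r) Fin.zero    _   zeros = trans (cong (λ z → g Fin.zero ℤ.+ z)
  (sumℤ-single (g ∘ Fin.suc) r (λ k k≢r → zeros (Fin.suc k) (k≢r ∘ Finₚ.suc-injective) (λ ()))))
  (ℤₚ.+-comm (g Fin.zero) (g (Fin.suc r)))
sumℤ-pair {suc n} g (Fin.suc r) (Fin.suc j) r≢j zeros rewrite zeros Fin.zero (λ ()) (λ ()) =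
  trans (ℤₚ.+-identityˡ _) (sumℤ-pair (g ∘ Fin.suc) r j (r≢j ∘ cong Fin.suc)
    (λ k k≢r k≢j → zeros (Fin.suc k) (k≢r ∘ Finₚ.suc-injective) (k≢j ∘ Finₚ.suc-injective)))

lookup-foldr-⊕ : ∀ {n} (xs : List (Zn n)) t →
  lookup (List.foldr _⊕_ (Vec.replicate n 0ℤ) xs) t ≡ sumℤ (List.map (λ u → lookup u t) xs)
lookup-foldr-⊕ []       t = Vecₚ.lookup-replicate t 0ℤ
lookup-foldr-⊕ (u ∷ xs) t = trans (lookup-⊕ u _ t) (cong (λ z → lookup u t ℤ.+ z) (lookup-foldr-⊕ xs t))

actTerm : ∀ {n} → V n → Zn n → Fin n → Fin n → ℤ
actTerm v x t k = (sgn (ε v k) ℤ.* lookup x k) ℤ.* δ t (β v k)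

lookup-act : ∀ {n} (v : V n) x t → lookup (act v x) t ≡ sumℤ (List.tabulate (actTerm v x t))
lookup-act {n} v x t = trans (lookup-foldr-⊕ (List.map image (allFin n)) t)
  (cong sumℤ (trans (sym (Listₚ.map-∘ (allFin n)))
    (trans (Listₚ.map-tabulate (λ k → k) (λ k → lookup (image k) t)) (Listₚ.tabulate-cong λ k →
      trans (Vecₚ.lookup-map t _ (e (β v k))) (cong (λ z → (sgn (ε v k) ℤ.* lookup x k) ℤ.* z) (lookup-e (β v k) t))))))
  where
  image : Fin n → Zn n
  image k = Vec.map ((sgn (ε v k) ℤ.* lookup x k) ℤ.*_) (e (β v k))

actTerm-zero : ∀ {n} (v : V n) x t k → lookup x k ≡ 0ℤ → actTerm v x t k ≡ 0ℤ
actTerm-zero v x t k xk≡0 rewrite xk≡0 | ℤₚ.*-zeroʳ (sgn (ε v k)) = refl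

sgn-*-1 : ∀ b d → (sgn b ℤ.* 1ℤ) ℤ.* d ≡ sgn b ℤ.* d
sgn-*-1 true  d = refl
sgn-*-1 false d = refl

sgn-*-neg1 : ∀ b d → (sgn b ℤ.* -1ℤ) ℤ.* d ≡ sgn (not b) ℤ.* d
sgn-*-neg1 true  d = refl
sgn-*-neg1 false d = refl

lookup-act-e : ∀ {n} (v : V n) r t → lookup (act v (e r)) t ≡ sgn (ε v r) ℤ.* δ t (β v r)
lookup-act-e v r t = begin
  lookup (act v (e r)) t                           ≡⟨ lookup-act v (e r) t ⟩
  sumℤ (List.tabulate (actTerm v (e r) t))         ≡⟨ sumℤ-single _ r (λ k k≢r →
                                                        actTerm-zero v (e r) t k (trans (lookup-e r k) (δ-≢ k r k≢r))) ⟩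
  actTerm v (e r) t r                              ≡⟨ cong (λ c → (sgn (ε v r) ℤ.* c) ℤ.* δ t (β v r))
                                                        (trans (lookup-e r r) (δ-refl r)) ⟩
  (sgn (ε v r) ℤ.* 1ℤ) ℤ.* δ t (β v r)             ≡⟨ sgn-*-1 (ε v r) _ ⟩
  sgn (ε v r) ℤ.* δ t (β v r)                      ∎
  where open ≡-Reasoning

module _ {n} (v : V n) (r j : Fin n) (r≢j : r ≢ j) where

  private
    lookup-e-r : lookup (e r) r ≡ 1ℤ
    lookup-e-r = trans (lookup-e r r) (δ-refl r)
    lookup-e-j : lookup (e j) j ≡ 1ℤ
    lookup-e-j = trans (lookup-e j j) (δ-refl j)
    lookup-e-rj : lookup (e r) j ≡ 0ℤ
    lookup-e-rj = trans (lookup-e r j) (δ-≢ j r (r≢j ∘ sym))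
    lookup-e-jr : lookup (e j) r ≡ 0ℤ
    lookup-e-jr = trans (lookup-e j r) (δ-≢ r j r≢j)
    lookup-e-off : ∀ (a k : Fin n) → k ≢ a → lookup (e a) k ≡ 0ℤ
    lookup-e-off a k k≢a = trans (lookup-e a k) (δ-≢ k a k≢a)

  lookup-act-e⊖e : ∀ t → lookup (act v (e r ⊖ e j)) t ≡
    sgn (ε v r) ℤ.* δ t (β v r) ℤ.+ sgn (not (ε v j)) ℤ.* δ t (β v j)
  lookup-act-e⊖e t = trans (lookup-act v (e r ⊖ e j) t) (trans
    (sumℤ-pair (actTerm v (e r ⊖ e j) t) r j r≢j (λ k k≢r k≢j → actTerm-zero v (e r ⊖ e j) t k (trans (lookup-⊖ (e r) (e j) k)
      (cong₂ ℤ._-_ (lookup-e-off r k k≢r) (lookup-e-off j k k≢j)))))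
    (cong₂ ℤ._+_
      (trans (cong (λ c → (sgn (ε v r) ℤ.* c) ℤ.* δ t (β v r))
        (trans (lookup-⊖ (e r) (e j) r) (cong₂ ℤ._-_ lookup-e-r lookup-e-jr))) (sgn-*-1 (ε v r) _))
      (trans (cong (λ c → (sgn (ε v j) ℤ.* c) ℤ.* δ t (β v j))
        (trans (lookup-⊖ (e r) (e j) j) (cong₂ ℤ._-_ lookup-e-rj lookup-e-j))) (sgn-*-neg1 (ε v j) _))))

  lookup-act-e⊕e : ∀ t → lookup (act v (e r ⊕ e j)) t ≡
    sgn (ε v r) ℤ.* δ t (β v r) ℤ.+ sgn (ε v j) ℤ.* δ t (β v j)
  lookup-act-e⊕e t = trans (lookup-act v (e r ⊕ e j) t) (trans
    (sumℤ-pair (actTerm v (e r ⊕ e j) t) r j r≢j (λ k k≢r k≢j → actTerm-zero v (e r ⊕ e j) t k (trans (lookup-⊕ (e r) (e j) k)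
      (cong₂ ℤ._+_ (lookup-e-off r k k≢r) (lookup-e-off j k k≢j)))))
    (cong₂ ℤ._+_
      (trans (cong (λ c → (sgn (ε v r) ℤ.* c) ℤ.* δ t (β v r))
        (trans (lookup-⊕ (e r) (e j) r) (cong₂ ℤ._+_ lookup-e-r lookup-e-jr))) (sgn-*-1 (ε v r) _))
      (trans (cong (λ c → (sgn (ε v j) ℤ.* c) ℤ.* δ t (β v j))
        (trans (lookup-⊕ (e r) (e j) j) (cong₂ ℤ._+_ lookup-e-rj lookup-e-j))) (sgn-*-1 (ε v j) _))))

negates : ∀ {n} → V n → Zn n → Bool
negates {n} v x = act v x ∈ᵇ Ψ⁻ n

negates-e : ∀ {n} (v : V n) r → negates v (e r) ≡ ε v r
negates-e v r = ∈ᵇΨ⁻-±e (act v (e r)) (β v r) (ε v r) (lookup-act-e v r)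

pairInversions-< : ∀ b x y → x < y → bit b + (bit b + 0) ≡ pairInversions b x y
pairInversions-< true  x y x<y = cong suc (sym (𝟙<-< x y x<y))
pairInversions-< false x y x<y rewrite 𝟙<-< x y x<y = refl

pairInversions-> : ∀ b c x y → y < x → bit (not c) + (bit c + 0) ≡ pairInversions b x y
pairInversions-> true  true  x y y<x rewrite 𝟙<-> x y y<x = refl
pairInversions-> true  false x y y<x rewrite 𝟙<-> x y y<x = refl
pairInversions-> false true  x y y<x rewrite 𝟙<-> x y y<x = refl
pairInversions-> false false x y y<x rewrite 𝟙<-> x y y<x = refl

negates-pair : ∀ {n} (v : V n) → InB v → ∀ r j → toℕ j < toℕ r →
  bit (negates v (e r ⊖ e j)) + (bit (negates v (e r ⊕ e j)) + 0) ≡ pairInversions (ε v r) (toℕ (β v j)) (toℕ (β v r))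
negates-pair v inB r j j<r with <-cmp (toℕ (β v j)) (toℕ (β v r))
... | tri< βj<βr _ _ = trans (cong₂ (λ p q → bit p + (bit q + 0))
        (∈ᵇΨ⁻-±e±e _ (β v r) (β v j) (ε v r) (not (ε v j)) βj<βr (lookup-act-e⊖e v r j r≢j))
        (∈ᵇΨ⁻-±e±e _ (β v r) (β v j) (ε v r) (ε v j) βj<βr (lookup-act-e⊕e v r j r≢j)))
      (pairInversions-< (ε v r) _ _ βj<βr)
  where
  r≢j : r ≢ j
  r≢j r≡j = <-irrefl (cong toℕ (sym r≡j)) j<r
... | tri≈ _ βj≡βr _ = ⊥-elim (<-irrefl (cong toℕ (InB⇒β-injective v inB j r (Finₚ.toℕ-injective βj≡βr))) j<r)
... | tri> _ _ βr<βj = trans (cong₂ (λ p q → bit p + (bit q + 0))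
        (∈ᵇΨ⁻-±e±e _ (β v j) (β v r) (not (ε v j)) (ε v r) βr<βj
          (λ t → trans (lookup-act-e⊖e v r j r≢j t) (ℤₚ.+-comm (sgn (ε v r) ℤ.* δ t (β v r)) _)))
        (∈ᵇΨ⁻-±e±e _ (β v j) (β v r) (ε v j) (ε v r) βr<βj
          (λ t → trans (lookup-act-e⊕e v r j r≢j t) (ℤₚ.+-comm (sgn (ε v r) ℤ.* δ t (β v r)) _))))
      (pairInversions-> (ε v r) (ε v j) _ _ βr<βj)
  where
  r≢j : r ≢ j
  r≢j r≡j = <-irrefl (cong toℕ (sym r≡j)) j<r

count : ∀ {A : Set} → (A → Bool) → List A → ℕ
count p xs = List.length (List.filterᵇ p xs)

count-∷ : ∀ {A : Set} (p : A → Bool) x xs → count p (x ∷ xs) ≡ bit (p x) + count p xs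
count-∷ p x xs with p x
... | true  = refl
... | false = refl

count-++ : ∀ {A : Set} (p : A → Bool) xs ys → count p (xs List.++ ys) ≡ count p xs + count p ys
count-++ p []       ys = refl
count-++ p (x ∷ xs) ys rewrite count-∷ p x (xs List.++ ys) | count-∷ p x xs | count-++ p xs ys =
  sym (+-assoc (bit (p x)) _ _)

count-concatMap : ∀ {A B : Set} (p : B → Bool) (f : A → List B) xs →
  count p (List.concatMap f xs) ≡ sum (List.map (count p ∘ f) xs)
count-concatMap p f []       = refl
count-concatMap p f (x ∷ xs) = trans (count-++ p (f x) (List.concatMap f xs)) (cong (count p (f x) +_) (count-concatMap p f xs))

sum-tabulate : ∀ {n} (h : Fin n → ℕ) (f : ℕ → ℕ) → (∀ i → h i ≡ f (toℕ i)) → sum (List.tabulate h) ≡ Σ< n f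
sum-tabulate {zero}  h f eq = refl
sum-tabulate {suc n} h f eq =
  trans (cong₂ _+_ (eq Fin.zero) (sum-tabulate (h ∘ Fin.suc) (f ∘ suc) (eq ∘ Fin.suc))) (sym (Σ<-suc n f))

below : ℕ → (ℕ → ℕ) → ℕ → ℕ
below r f k with k <? r
... | yes _ = f k
... | no _  = 0

below-< : ∀ r f k → k < r → below r f k ≡ f k
below-< r f k k<r with k <? r
... | yes _   = refl
... | no k≮r = ⊥-elim (k≮r k<r)

below-≥ : ∀ r f k → r ≤ k → below r f k ≡ 0
below-≥ r f k r≤k with k <? r
... | yes k<r = ⊥-elim (<-irrefl refl (<-≤-trans k<r r≤k))
... | no _    = refl

invAt≡invCode : ∀ {n} (v : V n) → InB v → ∀ r → invAt v r ≡ invCode ⟦ v ⟧ (toℕ r)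
invAt≡invCode {n} v inB r = begin
  count (negates v) (e r ∷ List.concatMap pairs (allFin n))        ≡⟨ count-∷ (negates v) (e r) _ ⟩
  bit (negates v (e r)) + count (negates v) (List.concatMap pairs (allFin n))
                                                                    ≡⟨ cong₂ _+_ (cong bit (negates-e v r))
                                                                                 (count-concatMap (negates v) pairs (allFin n)) ⟩
  bit (ε v r) + sum (List.map (count (negates v) ∘ pairs) (allFin n))
                                                                    ≡⟨ cong (λ xs → bit (ε v r) + sum xs)
                                                                         (Listₚ.map-tabulate (λ k → k) (count (negates v) ∘ pairs)) ⟩
  bit (ε v r) + sum (List.tabulate (count (negates v) ∘ pairs))    ≡⟨ cong (bit (ε v r) +_) (sum-tabulate _ _ count-pairs) ⟩
  bit (ε v r) + Σ< n (below (toℕ r) pairsAt)                       ≡⟨ cong (bit (ε v r) +_)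
                                                                         (Σ<-truncate n (toℕ r) _ (<⇒≤ (Finₚ.toℕ<n r))
                                                                           (λ k r≤k _ → below-≥ (toℕ r) pairsAt k r≤k)) ⟩
  bit (ε v r) + Σ< (toℕ r) (below (toℕ r) pairsAt)                 ≡⟨ cong (bit (ε v r) +_)
                                                                         (Σ<-cong (toℕ r) (below-< (toℕ r) pairsAt)) ⟩
  bit (ε v r) + Σ< (toℕ r) pairsAt                                  ≡⟨ cong₂ (λ p q → bit (proj₂ p) + q) ⟦v⟧r
                                                                         (Σ<-cong (toℕ r) (λ j _ → cong (λ p →
                                                                           pairInversions (proj₂ p) (proj₁ (⟦ v ⟧ j)) (proj₁ p)) ⟦v⟧r)) ⟨
  invCode ⟦ v ⟧ (toℕ r)                                             ∎
  where
  open ≡-Reasoning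
  pairs : Fin n → List (Zn n)
  pairs j = if toℕ j <ᵇ toℕ r then (e r ⊖ e j) ∷ (e r ⊕ e j) ∷ [] else []
  ⟦v⟧r : ⟦ v ⟧ (toℕ r) ≡ (toℕ (β v r) , ε v r)
  ⟦v⟧r = ⟦⟧-toℕ v r
  pairsAt : ℕ → ℕ
  pairsAt k = pairInversions (ε v r) (proj₁ (⟦ v ⟧ k)) (toℕ (β v r))
  count-pairs : ∀ i → count (negates v) (pairs i) ≡ below (toℕ r) pairsAt (toℕ i)
  count-pairs i = split (toℕ i <ᵇ toℕ r) refl
    where
    split : ∀ c → (toℕ i <ᵇ toℕ r) ≡ c →
      count (negates v) (if c then (e r ⊖ e i) ∷ (e r ⊕ e i) ∷ [] else []) ≡ below (toℕ r) pairsAt (toℕ i)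
    split true i<ᵇr = begin
      count (negates v) ((e r ⊖ e i) ∷ (e r ⊕ e i) ∷ [])                 ≡⟨ count-∷ (negates v) (e r ⊖ e i) _ ⟩
      bit (negates v (e r ⊖ e i)) + count (negates v) ((e r ⊕ e i) ∷ [])  ≡⟨ cong (bit (negates v (e r ⊖ e i)) +_)
                                                                              (count-∷ (negates v) (e r ⊕ e i) []) ⟩
      bit (negates v (e r ⊖ e i)) + (bit (negates v (e r ⊕ e i)) + 0)    ≡⟨ negates-pair v inB r i i<r ⟩
      pairInversions (ε v r) (toℕ (β v i)) (toℕ (β v r))                 ≡⟨ cong (λ p → pairInversions (ε v r) (proj₁ p) (toℕ (β v r)))
                                                                              (⟦⟧-toℕ v i) ⟨
      pairsAt (toℕ i)                                                    ≡⟨ below-< (toℕ r) pairsAt (toℕ i) i<r ⟨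
      below (toℕ r) pairsAt (toℕ i)                                      ∎
      where i<r = <ᵇ⇒< (toℕ i) (toℕ r) (Equivalence.from T-≡ i<ᵇr)
    split false i≮ᵇr = sym (below-≥ (toℕ r) pairsAt (toℕ i) (≮⇒≥ (λ i<r → subst T i≮ᵇr (<⇒<ᵇ i<r))))

sum-single : ∀ {n} (h : Fin n → ℕ) r → (∀ k → k ≢ r → h k ≡ 0) → sum (List.tabulate h) ≡ h r
sum-single {suc n} h Fin.zero zeros = trans (cong (h Fin.zero +_) (trans
  (sum-tabulate (h ∘ Fin.suc) (λ _ → 0) (λ k → zeros (Fin.suc k) (λ ()))) (Σ<-zero n _ (λ _ _ → refl))))
  (+-identityʳ _)
sum-single {suc n} h (Fin.suc r) zeros rewrite zeros Fin.zero (λ ()) =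
  sum-single (h ∘ Fin.suc) r (λ k k≢r → zeros (Fin.suc k) (k≢r ∘ Finₚ.suc-injective))

invᵢ≡invAt : ∀ {n} (v : V n) i (r : Fin n) → toℕ r ≡ n ∸ i → invᵢ i v ≡ invAt v r
invᵢ≡invAt {n} v i r r≡n-i = begin
  sum (List.map select (allFin n))     ≡⟨ cong sum (Listₚ.map-tabulate (λ k → k) select) ⟩
  sum (List.tabulate select)           ≡⟨ sum-single select r others ⟩
  select r                             ≡⟨ selected (toℕ r ≡ᵇ (n ∸ i)) (≡⇒≡ᵇ _ _ r≡n-i) ⟩
  invAt v r                            ∎
  where
  open ≡-Reasoning
  select : Fin n → ℕ
  select k = if toℕ k ≡ᵇ (n ∸ i) then invAt v k else 0
  others : ∀ k → k ≢ r → select k ≡ 0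
  others k k≢r with toℕ k ≡ᵇ (n ∸ i) in k≡ᵇn-i
  ... | true  = ⊥-elim (k≢r (Finₚ.toℕ-injective (trans (≡ᵇ⇒≡ _ _ (Equivalence.from T-≡ k≡ᵇn-i)) (sym r≡n-i))))
  ... | false = refl
  selected : ∀ c → T c → (if c then invAt v r else 0) ≡ invAt v r
  selected true _ = refl

invᵢ≡invCode : ∀ {n} (v : V n) → InB v → ∀ i → i < n → invᵢ (n ∸ i) v ≡ invCode ⟦ v ⟧ i
invᵢ≡invCode {n} v inB i i<n = begin
  invᵢ (n ∸ i) v                 ≡⟨ invᵢ≡invAt v (n ∸ i) (fromℕ< i<n)
                                      (trans (Finₚ.toℕ-fromℕ< i<n) (sym (m∸[m∸n]≡n (<⇒≤ i<n)))) ⟩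
  invAt v (fromℕ< i<n)           ≡⟨ invAt≡invCode v inB (fromℕ< i<n) ⟩
  invCode ⟦ v ⟧ (toℕ (fromℕ< i<n)) ≡⟨ cong (invCode ⟦ v ⟧) (Finₚ.toℕ-fromℕ< i<n) ⟩
  invCode ⟦ v ⟧ i                ∎
  where open ≡-Reasoning

φ-exponents : ∀ {m} → V (suc m) → Fin (suc m) → ℕ
φ-exponents {m} w k = invᵢ (suc m ∸ toℕ k) w

extend-φ-exponents : ∀ {m} (w : V (suc m)) → InB w → ∀ k → k < suc m → extend (φ-exponents w) k ≡ invCode ⟦ w ⟧ k
extend-φ-exponents w inB k k<n = trans (extend-< (φ-exponents w) k k<n)
  (trans (cong (λ i → invᵢ (_ ∸ i) w) (Finₚ.toℕ-fromℕ< k<n)) (invᵢ≡invCode w inB k k<n))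

⟦φ⟧ : ∀ {m} (w : V (suc m)) → InB w → ⟦ φ w ⟧ ≗ FlagNormalForm.prod (invCode ⟦ w ⟧) (suc m)
⟦φ⟧ {m} w inB x = trans (⟦σprod⟧ (φ-exponents w) x)
  (FlagNormalForm.prod-cong (suc m) _ _ (extend-φ-exponents w inB) x)

invCode-bounded : ∀ n f → Bounded n (invCode f)
invCode-bounded n f k _ = invCode<slots f k

inversionTable-invCode : ∀ n f → SignedPermOn n f → AgreeBelow n (InversionTable.prod (invCode f) n) f
inversionTable-invCode n f pf k k<n = trans (InversionTable.prod-cong n (invCode f) a invCode≡a k) (agree k k<n)
  where
  preimage = InversionTable.prod-surjective n f pf
  a = proj₁ preimage
  bnd = proj₁ (proj₂ preimage)
  agree = proj₂ (proj₂ preimage)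
  invCode≡a : ∀ j → j < n → invCode f j ≡ a j
  invCode≡a j j<n = trans (invCode-cong n f (InversionTable.prod a n) (λ i i<n → sym (agree i i<n)) j j<n)
    (invCode-inversionTable n a bnd j j<n)

invCode-injective : ∀ {n} (w w′ : V n) → InB w → InB w′ →
  (∀ j → j < n → invCode ⟦ w ⟧ j ≡ invCode ⟦ w′ ⟧ j) → w ≡ w′
invCode-injective {n} w w′ inB inB′ same = ⟦⟧-injective w w′ λ k k<n → begin
  ⟦ w ⟧ k                                    ≡⟨ inversionTable-invCode n ⟦ w ⟧ (InB⇒signedPerm w inB) k k<n ⟨
  InversionTable.prod (invCode ⟦ w ⟧) n k    ≡⟨ InversionTable.prod-cong n _ _ same k ⟩
  InversionTable.prod (invCode ⟦ w′ ⟧) n k   ≡⟨ inversionTable-invCode n ⟦ w′ ⟧ (InB⇒signedPerm w′ inB′) k k<n ⟩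
  ⟦ w′ ⟧ k                                   ∎
  where open ≡-Reasoning

φ-InB : ∀ m (w : V (suc m)) → InB w → InB (φ w)
φ-InB m w inB = signedPerm⇒InB (φ w) _
  (FlagNormalForm.prod-signedPerm (suc m) _ (invCode-bounded (suc m) ⟦ w ⟧)) (λ k _ → ⟦φ⟧ w inB k)

φ-injective : ∀ m (w w′ : V (suc m)) → InB w → InB w′ → φ w ≡ φ w′ → w ≡ w′
φ-injective m w w′ inB inB′ φw≡φw′ = invCode-injective w w′ inB inB′
  (FlagNormalForm.prod-injective (suc m) _ _ (invCode-bounded (suc m) ⟦ w ⟧) (invCode-bounded (suc m) ⟦ w′ ⟧)
    (λ k _ → trans (sym (⟦φ⟧ w inB k)) (trans (cong (λ u → ⟦ u ⟧ k) φw≡φw′) (⟦φ⟧ w′ inB′ k))))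

-- The preimage of u is the signed permutation whose inversion table is the
-- exponent vector of the normal form of u.
φ-surjective : ∀ m (u : V (suc m)) → InB u → Σ[ w ∈ V (suc m) ] InB w × φ w ≡ u
φ-surjective m u inB = w , inB-w , ⟦⟧-injective (φ w) u λ k k<n → begin
  ⟦ φ w ⟧ k                                    ≡⟨ ⟦φ⟧ w inB-w k ⟩
  FlagNormalForm.prod (invCode ⟦ w ⟧) n k      ≡⟨ FlagNormalForm.prod-cong n _ _ invCode≡a k ⟩
  FlagNormalForm.prod a n k                    ≡⟨ agree k k<n ⟩
  ⟦ u ⟧ k                                      ∎
  where
  open ≡-Reasoning
  n = suc m
  normalForm = FlagNormalForm.prod-surjective n ⟦ u ⟧ (InB⇒signedPerm u inB)
  a = proj₁ normalForm
  bnd = proj₁ (proj₂ normalForm)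
  agree = proj₂ (proj₂ normalForm)
  table = InversionTable.prod-signedPerm n a bnd
  w = fromSignedMap (InversionTable.prod a n) (image< table)
  inB-w : InB w
  inB-w = signedPerm⇒InB w (InversionTable.prod a n) table (⟦fromSignedMap⟧ (InversionTable.prod a n) (image< table))
  invCode≡a : ∀ j → j < n → invCode ⟦ w ⟧ j ≡ a j
  invCode≡a j j<n = trans (invCode-cong n ⟦ w ⟧ (InversionTable.prod a n)
    (⟦fromSignedMap⟧ (InversionTable.prod a n) (image< table)) j j<n) (invCode-inversionTable n a bnd j j<n)

sum-map-applyUpTo : ∀ n (f g : ℕ → ℕ) → sum (List.map g (List.applyUpTo f n)) ≡ Σ< n (g ∘ f)
sum-map-applyUpTo zero    f g = refl
sum-map-applyUpTo (suc n) f g = trans (cong (g (f 0) +_) (sum-map-applyUpTo n (f ∘ suc) g)) (sym (Σ<-suc n _))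

inv≡Σ<invCode : ∀ {n} (w : V n) → InB w → inv w ≡ Σ< n (invCode ⟦ w ⟧)
inv≡Σ<invCode {n} w inB = begin
  sum (List.map (λ i → invᵢ (suc i) w) (List.upTo n))   ≡⟨ sum-map-applyUpTo n (λ i → i) (λ i → invᵢ (suc i) w) ⟩
  Σ< n (λ i → invᵢ (suc i) w)                           ≡⟨ Σ<-cong n (λ i i<n → trans
                                                              (cong (λ j → invᵢ j w) (sym (m∸[m∸n]≡n i<n)))
                                                              (invᵢ≡invCode w inB (n ∸ suc i) (∸-monoʳ-< ℕ.z<s i<n))) ⟩
  Σ< n (λ i → invCode ⟦ w ⟧ (n ∸ suc i))                ≡⟨ Σ<-reverse n (invCode ⟦ w ⟧) ⟩
  Σ< n (invCode ⟦ w ⟧)                                  ∎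
  where open ≡-Reasoning

∈-tuplesFrom⁺ : ∀ l st (k : Vec ℕ l) → (∀ i → lookup k i < slots (st + toℕ i)) → k ∈ tuplesFrom l st
∈-tuplesFrom⁺ zero    st Vec.[]         _   = here refl
∈-tuplesFrom⁺ (suc l) st (x Vec.∷ xs) bnd =
  ∈-concatMap⁺ _ (lose (∈-upTo⁺ x<slots) (∈-map⁺ (x Vec.∷_) (∈-tuplesFrom⁺ l (suc st) xs bnd′)))
  where
  x<slots : x < slots st
  x<slots = subst (λ j → x < slots j) (+-identityʳ st) (bnd Fin.zero)
  bnd′ : ∀ i → lookup xs i < slots (suc st + toℕ i)
  bnd′ i = subst (λ j → lookup xs i < slots j) (+-suc st (toℕ i)) (bnd (Fin.suc i))

∈-tuplesFrom⁻ : ∀ l st (k : Vec ℕ l) → k ∈ tuplesFrom l st → ∀ i → lookup k i < slots (st + toℕ i)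
∈-tuplesFrom⁻ (suc l) st k k∈ i with find (∈-concatMap⁻ _ {xs = List.upTo (slots st)} k∈)
... | x , x∈upTo , k∈x∷ with ∈-map⁻ (x Vec.∷_) k∈x∷
...   | xs , xs∈ , refl with i
...     | Fin.zero   = subst (λ j → x < slots j) (sym (+-identityʳ st)) (∈-upTo⁻ x∈upTo)
...     | Fin.suc i′ = subst (λ j → lookup xs i′ < slots j) (sym (+-suc st (toℕ i′)))
                         (∈-tuplesFrom⁻ l (suc st) xs xs∈ i′)

tuplesFrom-bounded : ∀ n (k : Vec ℕ n) → k ∈ tuplesFrom n 0 → Bounded n (extend (lookup k))
tuplesFrom-bounded n k k∈ j j<n = subst₂ _<_ (sym (extend-< (lookup k) j j<n))
  (cong slots (Finₚ.toℕ-fromℕ< j<n)) (∈-tuplesFrom⁻ n 0 k k∈ (fromℕ< j<n))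

bounded-∈-tuplesFrom : ∀ n (a : Fin n → ℕ) → Bounded n (extend a) → tabulate a ∈ tuplesFrom n 0
bounded-∈-tuplesFrom n a bnd = ∈-tuplesFrom⁺ n 0 (tabulate a) λ i →
  subst (_< slots (toℕ i)) (trans (extend-toℕ a i) (sym (Vecₚ.lookup∘tabulate a i))) (bnd (toℕ i) (Finₚ.toℕ<n i))

Vec-sum≡Σ< : ∀ {n} (k : Vec ℕ n) → Vec.sum k ≡ Σ< n (extend (lookup k))
Vec-sum≡Σ< Vec.[] = refl
Vec-sum≡Σ< {suc n} (x Vec.∷ xs) = trans
  (cong₂ _+_ (sym (extend-< (lookup (x Vec.∷ xs)) 0 (s≤s z≤n)))
    (trans (Vec-sum≡Σ< xs) (Σ<-cong n (λ j j<n →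
      trans (extend-< (lookup xs) j j<n) (sym (extend-< (lookup (x Vec.∷ xs)) (suc j) (s≤s j<n)))))))
  (sym (Σ<-suc n _))

foldr-select : ∀ {A : Set} (p : A → Bool) (f : A → ℕ) (c : ℕ) xs →
  (∀ x → x ∈ xs → p x ≡ true → f x ≡ c) → Σ[ x ∈ A ] x ∈ xs × p x ≡ true →
  List.foldr (λ x rest → if p x then f x else rest) 0 xs ≡ c
foldr-select p f c (y ∷ xs) only (x , x∈ , px) with p y in py
... | true = only y (here refl) py
foldr-select p f c (y ∷ xs) only (x , here refl , px) | false with () ← trans (sym py) px
foldr-select p f c (y ∷ xs) only (x , there x∈xs , px) | false =
  foldr-select p f c xs (λ z z∈xs → only z (there z∈xs)) (x , x∈xs , px)

σprod-injective : ∀ {m} (a a′ : Fin (suc m) → ℕ) → Bounded (suc m) (extend a) → Bounded (suc m) (extend a′) →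
  σprod a ≡ σprod a′ → ∀ j → j < suc m → extend a j ≡ extend a′ j
σprod-injective {m} a a′ bnd bnd′ eq = FlagNormalForm.prod-injective (suc m) _ _ bnd bnd′
  (λ j _ → trans (sym (⟦σprod⟧ a j)) (trans (cong (λ u → ⟦ u ⟧ j) eq) (⟦σprod⟧ a′ j)))

σprod-cong : ∀ {m} (a a′ : Fin (suc m) → ℕ) → (∀ i → a i ≡ a′ i) → σprod a ≡ σprod a′
σprod-cong {m} a a′ a≗a′ = ⟦⟧-injective (σprod a) (σprod a′) λ k _ →
  trans (⟦σprod⟧ a k) (trans (FlagNormalForm.prod-cong (suc m) _ _ extend≡ k) (sym (⟦σprod⟧ a′ k)))
  where
  extend≡ : ∀ j → j < suc m → extend a j ≡ extend a′ j
  extend≡ j j<n = trans (extend-< a j j<n) (trans (a≗a′ _) (sym (extend-< a′ j j<n)))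

-- The normal form of σprod a is found at its exponent tuple, and every tuple
-- found there has the same exponents by uniqueness of the normal form.
fmaj-σprod : ∀ {m} (a : Fin (suc m) → ℕ) → Bounded (suc m) (extend a) → fmaj (σprod a) ≡ Σ< (suc m) (extend a)
fmaj-σprod {m} a bnd = foldr-select _ Vec.sum _ (tuplesFrom (suc m) 0) only
  (tabulate a , bounded-∈-tuplesFrom (suc m) a bnd , trans (isYes≗does found?) (dec-true found? same))
  where
  found? = σprod (lookup (tabulate a)) ≟V σprod a
  same : σprod (lookup (tabulate a)) ≡ σprod a
  same = σprod-cong (lookup (tabulate a)) a (Vecₚ.lookup∘tabulate a)
  only : ∀ k → k ∈ tuplesFrom (suc m) 0 → ⌊ σprod (lookup k) ≟V σprod a ⌋ ≡ true → Vec.sum k ≡ Σ< (suc m) (extend a)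
  only k k∈ found = trans (Vec-sum≡Σ< k) (Σ<-cong (suc m)
    (σprod-injective (lookup k) a (tuplesFrom-bounded (suc m) k k∈) bnd (toWitness (Equivalence.from T-≡ found))))

inv≡fmaj∘φ : ∀ m (w : V (suc m)) → InB w → inv w ≡ fmaj (φ w)
inv≡fmaj∘φ m w inB = begin
  inv w                                  ≡⟨ inv≡Σ<invCode w inB ⟩
  Σ< (suc m) (invCode ⟦ w ⟧)             ≡⟨ Σ<-cong (suc m) (extend-φ-exponents w inB) ⟨
  Σ< (suc m) (extend (φ-exponents w))    ≡⟨ fmaj-σprod (φ-exponents w) bnd ⟨
  fmaj (φ w)                             ∎
  where
  open ≡-Reasoning
  bnd : Bounded (suc m) (extend (φ-exponents w))
  bnd k k<n = subst (_< slots k) (sym (extend-φ-exponents w inB k k<n)) (invCode<slots ⟦ w ⟧ k)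

map-bijection-↭ : ∀ {A B : Set} (f : A → B) (xs : List A) (ys : List B) → Unique xs → Unique ys →
  (∀ {x} → x ∈ xs → f x ∈ ys) → (∀ {x x′} → x ∈ xs → x′ ∈ xs → f x ≡ f x′ → x ≡ x′) →
  (∀ {y} → y ∈ ys → Σ[ x ∈ A ] x ∈ xs × f x ≡ y) → List.map f xs ↭ ys
map-bijection-↭ f xs ys xs! ys! into inj onto =
  ∼bag⇒↭ (unique∧set⇒bag (unique-map xs! inj) ys! (mk⇔ to from))
  where
  unique-map : ∀ {xs} → Unique xs → (∀ {x x′} → x ∈ xs → x′ ∈ xs → f x ≡ f x′ → x ≡ x′) → Unique (List.map f xs)
  unique-map {[]}     _               _   = AllPairs.[]
  unique-map {x ∷ xs} (x∉xs AllPairs.∷ xs!) inj =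
    Allₚ.map⁺ (All.tabulate (λ x′∈xs fx≡fx′ → All.lookup x∉xs x′∈xs (inj (here refl) (there x′∈xs) fx≡fx′)))
    AllPairs.∷ unique-map xs! (λ x∈ x′∈ → inj (there x∈) (there x′∈))
  to : ∀ {y} → y ∈ List.map f xs → y ∈ ys
  to y∈ with ∈-map⁻ f y∈
  ... | x , x∈xs , refl = into x∈xs
  from : ∀ {y} → y ∈ ys → y ∈ List.map f xs
  from y∈ys with onto y∈ys
  ... | x , x∈xs , refl = ∈-map⁺ f x∈xs

concatMap-map≡cartesianProductWith : ∀ {A B C : Set} (f : A → B → C) xs ys →
  List.concatMap (λ x → List.map (f x) ys) xs ≡ List.cartesianProductWith f xs ys
concatMap-map≡cartesianProductWith f []       ys = refl
concatMap-map≡cartesianProductWith f (x ∷ xs) ys = cong (List.map (f x) ys List.++_) (concatMap-map≡cartesianProductWith f xs ys)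

∷-injective : ∀ {A : Set} {m} {x x′ : A} {xs xs′ : Vec A m} → x Vec.∷ xs ≡ x′ Vec.∷ xs′ → x ≡ x′ × xs ≡ xs′
∷-injective refl = refl , refl

allVecs-unique : ∀ {A : Set} m (xs : List A) → Unique xs → Unique (allVecs m xs)
allVecs-unique zero    xs xs! = All.[] AllPairs.∷ AllPairs.[]
allVecs-unique (suc m) xs xs! = subst Unique (sym (concatMap-map≡cartesianProductWith Vec._∷_ xs (allVecs m xs)))
  (Uniqueₚ.cartesianProductWith⁺ Vec._∷_ ∷-injective xs! (allVecs-unique m xs xs!))

∈-allVecs : ∀ {A : Set} m (xs : List A) (v : Vec A m) → (∀ i → lookup v i ∈ xs) → v ∈ allVecs m xs
∈-allVecs zero    xs Vec.[]         _   = here refl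
∈-allVecs (suc m) xs (y Vec.∷ ys) all∈ =
  ∈-concatMap⁺ _ (lose (all∈ Fin.zero) (∈-map⁺ (y Vec.∷_) (∈-allVecs m xs ys (all∈ ∘ Fin.suc))))

allB-unique : ∀ n → Unique (allB n)
allB-unique n = Uniqueₚ.filter⁺ (T? ∘ isSignedPerm)
  (allVecs-unique n _ (Uniqueₚ.cartesianProduct⁺ (Uniqueₚ.allFin⁺ n) signs!))
  where
  signs! : Unique (false ∷ true ∷ [])
  signs! = ((λ ()) All.∷ All.[]) AllPairs.∷ (All.[] AllPairs.∷ AllPairs.[])

InB⇒∈allB : ∀ {n} (w : V n) → InB w → w ∈ allB n
InB⇒∈allB {n} w inB = ∈-filter⁺ (T? ∘ isSignedPerm)
  (∈-allVecs n _ w (λ i → ∈-cartesianProduct⁺ (∈-allFin _) (sign∈ _))) (Equivalence.from T-≡ inB)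
  where
  sign∈ : ∀ b → b ∈ false ∷ true ∷ []
  sign∈ false = here refl
  sign∈ true  = there (here refl)

∈allB⇒InB : ∀ {n} (w : V n) → w ∈ allB n → InB w
∈allB⇒InB {n} w w∈ = Equivalence.to T-≡
  (proj₂ (∈-filter⁻ (T? ∘ isSignedPerm) {xs = allVecs n (List.cartesianProduct (allFin n) (false ∷ true ∷ []))} w∈))

tuplesFrom-unique : ∀ l st → Unique (tuplesFrom l st)
tuplesFrom-unique zero    st = All.[] AllPairs.∷ AllPairs.[]
tuplesFrom-unique (suc l) st =
  subst Unique (sym (concatMap-map≡cartesianProductWith Vec._∷_ (List.upTo (slots st)) (tuplesFrom l (suc st))))
    (Uniqueₚ.cartesianProductWith⁺ Vec._∷_ ∷-injective (Uniqueₚ.upTo⁺ (slots st)) (tuplesFrom-unique l (suc st)))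

φ-↭ : ∀ m → List.map φ (allB (suc m)) ↭ allB (suc m)
φ-↭ m = map-bijection-↭ φ (allB (suc m)) (allB (suc m)) (allB-unique (suc m)) (allB-unique (suc m)) into inj onto
  where
  into : ∀ {w} → w ∈ allB (suc m) → φ w ∈ allB (suc m)
  into {w} w∈ = InB⇒∈allB (φ w) (φ-InB m w (∈allB⇒InB w w∈))
  inj : ∀ {w w′} → w ∈ allB (suc m) → w′ ∈ allB (suc m) → φ w ≡ φ w′ → w ≡ w′
  inj {w} {w′} w∈ w′∈ = φ-injective m w w′ (∈allB⇒InB w w∈) (∈allB⇒InB w′ w′∈)
  onto : ∀ {u} → u ∈ allB (suc m) → Σ[ w ∈ V (suc m) ] w ∈ allB (suc m) × φ w ≡ u
  onto {u} u∈ = let (w , inB-w , φw≡u) = φ-surjective m u (∈allB⇒InB u u∈) in w , InB⇒∈allB w inB-w , φw≡u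

σprod-↭ : ∀ m → List.map (σprod {m} ∘ lookup) (tuplesFrom (suc m) 0) ↭ allB (suc m)
σprod-↭ m = map-bijection-↭ (σprod ∘ lookup) (tuplesFrom n 0) (allB n) (tuplesFrom-unique n 0) (allB-unique n)
  into inj onto
  where
  n = suc m
  into : ∀ {k} → k ∈ tuplesFrom n 0 → σprod (lookup k) ∈ allB n
  into {k} k∈ = InB⇒∈allB (σprod (lookup k)) (signedPerm⇒InB (σprod (lookup k)) (FlagNormalForm.prod (extend (lookup k)) n)
    (FlagNormalForm.prod-signedPerm n (extend (lookup k)) (tuplesFrom-bounded n k k∈)) (λ j _ → ⟦σprod⟧ (lookup k) j))
  inj : ∀ {k k′} → k ∈ tuplesFrom n 0 → k′ ∈ tuplesFrom n 0 → σprod (lookup k) ≡ σprod (lookup k′) → k ≡ k′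
  inj {k} {k′} k∈ k′∈ eq = lookup-ext k k′ λ i → begin
    lookup k i                 ≡⟨ extend-toℕ (lookup k) i ⟨
    extend (lookup k) (toℕ i)  ≡⟨ σprod-injective (lookup k) (lookup k′) (tuplesFrom-bounded n k k∈)
                                    (tuplesFrom-bounded n k′ k′∈) eq (toℕ i) (Finₚ.toℕ<n i) ⟩
    extend (lookup k′) (toℕ i) ≡⟨ extend-toℕ (lookup k′) i ⟩
    lookup k′ i                ∎
    where open ≡-Reasoning
  onto : ∀ {u} → u ∈ allB n → Σ[ k ∈ Vec ℕ n ] k ∈ tuplesFrom n 0 × σprod (lookup k) ≡ u
  onto {u} u∈ = tabulate a′ , bounded-∈-tuplesFrom n a′ bnd′ , ⟦⟧-injective (σprod (lookup (tabulate a′))) u λ j j<n →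
    trans (⟦σprod⟧ (lookup (tabulate a′)) j) (trans (FlagNormalForm.prod-cong n _ _ extend≡ j) (agree j j<n))
    where
    normalForm = FlagNormalForm.prod-surjective n ⟦ u ⟧ (InB⇒signedPerm u (∈allB⇒InB u u∈))
    a = proj₁ normalForm
    bnd = proj₁ (proj₂ normalForm)
    agree = proj₂ (proj₂ normalForm)
    a′ : Fin n → ℕ
    a′ = a ∘ toℕ
    extend-a′ : ∀ j → j < n → extend a′ j ≡ a j
    extend-a′ j j<n = trans (extend-< a′ j j<n) (cong a (Finₚ.toℕ-fromℕ< j<n))
    extend≡ : ∀ j → j < n → extend (lookup (tabulate a′)) j ≡ a j
    extend≡ j j<n = trans (extend-< (lookup (tabulate a′)) j j<n)
      (trans (Vecₚ.lookup∘tabulate a′ (fromℕ< j<n)) (cong a (Finₚ.toℕ-fromℕ< j<n)))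
    bnd′ : Bounded n (extend a′)
    bnd′ j j<n = subst (_< slots j) (sym (extend-a′ j j<n)) (bnd j j<n)

-- Generating functions

sumℤ-↭ : ∀ {xs ys} → xs ↭ ys → sumℤ xs ≡ sumℤ ys
sumℤ-↭ xs↭ys = foldr-commMonoid (setoid ℤ) ℤₚ.+-0-isCommutativeMonoid (↭⇒↭ₛ xs↭ys)

sumℤ-++ : ∀ xs ys → sumℤ (xs List.++ ys) ≡ sumℤ xs ℤ.+ sumℤ ys
sumℤ-++ []       ys = sym (ℤₚ.+-identityˡ (sumℤ ys))
sumℤ-++ (x ∷ xs) ys = trans (cong (λ z → x ℤ.+ z) (sumℤ-++ xs ys)) (sym (ℤₚ.+-assoc x (sumℤ xs) (sumℤ ys)))

sumℤ-*ʳ : ∀ {A : Set} (c : ℤ) (f : A → ℤ) xs → sumℤ (List.map (λ x → f x * c) xs) ≡ sumℤ (List.map f xs) * c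
sumℤ-*ʳ c f []       = sym (ℤₚ.*-zeroˡ c)
sumℤ-*ʳ c f (x ∷ xs) = trans (cong (λ z → f x * c ℤ.+ z) (sumℤ-*ʳ c f xs)) (sym (ℤₚ.*-distribʳ-+ c (f x) _))

sumℤ-concatMap-map : ∀ {A B : Set} (g : B → ℤ) (f : A → List B) xs →
  sumℤ (List.map g (List.concatMap f xs)) ≡ sumℤ (List.map (λ x → sumℤ (List.map g (f x))) xs)
sumℤ-concatMap-map g f []       = refl
sumℤ-concatMap-map g f (x ∷ xs) = trans (cong sumℤ (Listₚ.map-++ g (f x) (List.concatMap f xs)))
  (trans (sumℤ-++ (List.map g (f x)) _) (cong (λ z → sumℤ (List.map g (f x)) ℤ.+ z) (sumℤ-concatMap-map g f xs)))

genfun-φ : ∀ m q → genfun {suc m} inv q ≡ genfun {suc m} (fmaj {m}) q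
genfun-φ m q = begin
  sumℤ (List.map (λ w → q ^ inv w) (allB n))          ≡⟨ cong sumℤ (Listₚ.map-cong-local (All.tabulate λ {w} w∈ →
                                                            cong (q ^_) (inv≡fmaj∘φ m w (∈allB⇒InB w w∈)))) ⟩
  sumℤ (List.map (λ w → q ^ fmaj (φ w)) (allB n))     ≡⟨ cong sumℤ (Listₚ.map-∘ (allB n)) ⟩
  sumℤ (List.map (λ w → q ^ fmaj w) (List.map φ (allB n)))
                                                       ≡⟨ sumℤ-↭ (↭ₚ.map⁺ (λ w → q ^ fmaj w) (φ-↭ m)) ⟩
  sumℤ (List.map (λ w → q ^ fmaj w) (allB n))         ∎
  where
  open ≡-Reasoning
  n = suc m

tuplesGF : ℤ → ℕ → ℕ → ℤ
tuplesGF q l st = sumℤ (List.map (λ k → q ^ Vec.sum k) (tuplesFrom l st))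

genfun-fmaj≡tuplesGF : ∀ m q → genfun {suc m} (fmaj {m}) q ≡ tuplesGF q (suc m) 0
genfun-fmaj≡tuplesGF m q = begin
  sumℤ (List.map (λ w → q ^ fmaj w) (allB n))
      ≡⟨ sumℤ-↭ (↭ₚ.map⁺ (λ w → q ^ fmaj w) (σprod-↭ m)) ⟨
  sumℤ (List.map (λ w → q ^ fmaj w) (List.map (σprod ∘ lookup) tuples))
      ≡⟨ cong sumℤ (Listₚ.map-∘ tuples) ⟨
  sumℤ (List.map (λ k → q ^ fmaj (σprod (lookup k))) tuples)
      ≡⟨ cong sumℤ (Listₚ.map-cong-local (All.tabulate λ {k} k∈ → cong (q ^_)
           (trans (fmaj-σprod (lookup k) (tuplesFrom-bounded n k k∈)) (sym (Vec-sum≡Σ< k))))) ⟩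
  sumℤ (List.map (λ k → q ^ Vec.sum k) tuples)  ∎
  where
  open ≡-Reasoning
  n = suc m
  tuples = tuplesFrom n 0

applyUpTo-cong : ∀ {A : Set} {f g : ℕ → A} → f ≗ g → ∀ l → List.applyUpTo f l ≡ List.applyUpTo g l
applyUpTo-cong f≗g zero    = refl
applyUpTo-cong f≗g (suc l) = cong₂ _∷_ (f≗g 0) (applyUpTo-cong (f≗g ∘ suc) l)

geometric-sum : ∀ q l off → (1ℤ - q) * sumℤ (List.map (q ^_) (List.applyUpTo (off +_) l)) ≡ q ^ off - q ^ (off + l)
geometric-sum q zero off rewrite +-identityʳ off = trans (ℤₚ.*-zeroʳ (1ℤ - q)) (sym (ℤₚ.+-inverseʳ (q ^ off)))
geometric-sum q (suc l) off = begin
  (1ℤ - q) * (q ^ (off + 0) ℤ.+ sumℤ (List.map (q ^_) (List.applyUpTo (λ i → off + suc i) l)))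
      ≡⟨ cong₂ (λ i is → (1ℤ - q) * (q ^ i ℤ.+ sumℤ (List.map (q ^_) is))) (+-identityʳ off)
               (applyUpTo-cong (+-suc off) l) ⟩
  (1ℤ - q) * (q ^ off ℤ.+ sumℤ (List.map (q ^_) (List.applyUpTo (suc off +_) l)))
      ≡⟨ ℤₚ.*-distribˡ-+ (1ℤ - q) (q ^ off) _ ⟩
  (1ℤ - q) * q ^ off ℤ.+ (1ℤ - q) * sumℤ (List.map (q ^_) (List.applyUpTo (suc off +_) l))
      ≡⟨ cong (λ z → (1ℤ - q) * q ^ off ℤ.+ z) (geometric-sum q l (suc off)) ⟩
  (1ℤ - q) * q ^ off ℤ.+ (q * q ^ off - q ^ (suc off + l))
      ≡⟨ telescope q (q ^ off) (q ^ (suc off + l)) ⟩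
  q ^ off - q ^ (suc off + l)
      ≡⟨ cong (λ i → q ^ off - q ^ i) (+-suc off l) ⟨
  q ^ off - q ^ (off + suc l)  ∎
  where
  open ≡-Reasoning
  telescope : ∀ q a b → (1ℤ - q) * a ℤ.+ (q * a - b) ≡ a - b
  telescope = solve 3 (λ q a b → (con 1ℤ :- q) :* a :+ (q :* a :- b) := a :- b) refl
    where open +-*-Solver

productFrom : ℤ → (ℕ → ℕ) → ℕ → ℤ
productFrom q f l = List.foldr _*_ 1ℤ (List.map (λ i → 1ℤ - q ^ (2 ℕ.* suc i)) (List.applyUpTo f l))

tuplesGF-suc : ∀ q l st → tuplesGF q (suc l) st ≡ sumℤ (List.map (q ^_) (List.upTo (slots st))) * tuplesGF q l (suc st)
tuplesGF-suc q l st = begin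
  sumℤ (List.map (λ k → q ^ Vec.sum k) (List.concatMap (λ x → List.map (x Vec.∷_) tuples) (List.upTo (slots st))))
      ≡⟨ sumℤ-concatMap-map (λ k → q ^ Vec.sum k) (λ x → List.map (x Vec.∷_) tuples) (List.upTo (slots st)) ⟩
  sumℤ (List.map (λ x → sumℤ (List.map (λ k → q ^ Vec.sum k) (List.map (x Vec.∷_) tuples))) (List.upTo (slots st)))
      ≡⟨ cong sumℤ (Listₚ.map-cong first-exponent (List.upTo (slots st))) ⟩
  sumℤ (List.map (λ x → q ^ x * tuplesGF q l (suc st)) (List.upTo (slots st)))
      ≡⟨ sumℤ-*ʳ (tuplesGF q l (suc st)) (q ^_) (List.upTo (slots st)) ⟩
  sumℤ (List.map (q ^_) (List.upTo (slots st))) * tuplesGF q l (suc st)  ∎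
  where
  open ≡-Reasoning
  tuples = tuplesFrom l (suc st)
  first-exponent : ∀ x → sumℤ (List.map (λ k → q ^ Vec.sum k) (List.map (x Vec.∷_) tuples)) ≡ q ^ x * tuplesGF q l (suc st)
  first-exponent x = begin
    sumℤ (List.map (λ k → q ^ Vec.sum k) (List.map (x Vec.∷_) tuples))
        ≡⟨ cong sumℤ (Listₚ.map-∘ tuples) ⟨
    sumℤ (List.map (λ k → q ^ (x + Vec.sum k)) tuples)
        ≡⟨ cong sumℤ (Listₚ.map-cong (λ k → ℤₚ.^-distribˡ-+-* q x (Vec.sum k)) tuples) ⟩
    sumℤ (List.map (λ k → q ^ x * q ^ Vec.sum k) tuples)
        ≡⟨ cong sumℤ (Listₚ.map-cong (λ k → ℤₚ.*-comm (q ^ x) _) tuples) ⟩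
    sumℤ (List.map (λ k → q ^ Vec.sum k * q ^ x) tuples)
        ≡⟨ sumℤ-*ʳ (q ^ x) _ tuples ⟩
    tuplesGF q l (suc st) * q ^ x
        ≡⟨ ℤₚ.*-comm _ (q ^ x) ⟩
    q ^ x * tuplesGF q l (suc st)  ∎

tuplesGF-product : ∀ q l st → (1ℤ - q) ^ l * tuplesGF q l st ≡ productFrom q (st +_) l
tuplesGF-product q zero    st = refl
tuplesGF-product q (suc l) st = begin
  ((1ℤ - q) * (1ℤ - q) ^ l) * tuplesGF q (suc l) st
      ≡⟨ cong ((1ℤ - q) * (1ℤ - q) ^ l *_) (tuplesGF-suc q l st) ⟩
  ((1ℤ - q) * (1ℤ - q) ^ l) * (sumℤ (List.map (q ^_) (List.upTo (slots st))) * tuplesGF q l (suc st))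
      ≡⟨ interchange (1ℤ - q) ((1ℤ - q) ^ l) _ _ ⟩
  ((1ℤ - q) * sumℤ (List.map (q ^_) (List.upTo (slots st)))) * ((1ℤ - q) ^ l * tuplesGF q l (suc st))
      ≡⟨ cong₂ _*_ (geometric-sum q (slots st) 0) (tuplesGF-product q l (suc st)) ⟩
  (1ℤ - q ^ slots st) * productFrom q (suc st +_) l
      ≡⟨ cong₂ (λ i is → (1ℤ - q ^ i) * List.foldr _*_ 1ℤ (List.map (λ i → 1ℤ - q ^ (2 ℕ.* suc i)) is))
               (slots≡2*suc st) (applyUpTo-cong (λ i → sym (+-suc st i)) l) ⟩
  productFrom q (st +_) (suc l)  ∎
  where
  open ≡-Reasoning
  slots≡2*suc : ∀ st → slots st ≡ 2 ℕ.* suc (st + 0)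
  slots≡2*suc st = trans (+-comm (2 ℕ.* st) 2) (trans (sym (*-suc 2 st)) (cong (λ i → 2 ℕ.* suc i) (sym (+-identityʳ st))))

mainTheorem7 : (m : ℕ) →
      ((w : V (suc m)) → InB w → InB (φ w))
    × ((w w′ : V (suc m)) → InB w → InB w′ → φ w ≡ φ w′ → w ≡ w′)
    × ((u : V (suc m)) → InB u → Σ (V (suc m)) (λ w → InB w × φ w ≡ u))
    × ((w : V (suc m)) → InB w → inv w ≡ fmaj (φ w))
    × ((q : ℤ) → genfun {suc m} inv q ≡ genfun {suc m} (fmaj {m}) q)
    × ((q : ℤ) → ((1ℤ - q) ^ suc m) * genfun {suc m} inv q ≡ prodRHS (suc m) q)
mainTheorem7 m =
    φ-InB m
  , φ-injective m
  , φ-surjective m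
  , inv≡fmaj∘φ m
  , genfun-φ m
  , λ q → trans (cong ((1ℤ - q) ^ suc m *_) (trans (genfun-φ m q) (genfun-fmaj≡tuplesGF m q)))
                (tuplesGF-product q (suc m) 0)
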